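{- Let $n\ge 2$ and let $\mathcal{S}$ be a set of pairwise nonisomorphic loopless frameless powerful sets of order $n$ (i.e. subsets of $\mathbb{F}_2^n$) and size $2^{n-2}$. Let $\mathcal{S}^{\diamond 2}:=\{S_1\diamond S_2\mid S_1,S_2\in\mathcal{S}\}$. Then every member of $\mathcal{S}^{\diamond2}$ is a loopless frameless powerful set of order $n+3$ and size $2^{n+1}$, and these sets are pairwise nonisomorphic, in the sense that for $S_1,S_2,S_1',S_2'\in\mathcal{S}$, if $S_1\diamond S_2\cong S_1'\diamond S_2'$ then $S_1\cong S_1'$ and $S_2\cong S_2'$. Moreover, if $n>3$, then every member of $\mathcal{S}^{\diamond2}$ is nonlinear (not a linear subspace).
   Context: A set $S\subseteq\mathbb{F}_2^n$ (positions indexed by $[n]$; $n$ is its order) is a powerful set if for every $X\subseteq[n]$ the number of vectors in $S$ that are zero in all positions of $X$ is a power of $2$. A position $e$ is a loop of $S$ if every vector of $S$ is $0$ at $e$; $e$ is a frame of $S$ if $\mathbf{0}\in S$, the unit vector with a single $1$ at $e$ is not in $S$, and every nonzero vector of $S$ is $1$ at $e$. $S$ is loopless (frameless) if it has no loop (frame). Two sets $S\subseteq\mathbb{F}_2^{E}$, $S'\subseteq\mathbb{F}_2^{E'}$ are isomorphic, $S\cong S'$, if some bijection $E\to E'$ of coordinate positions induces a bijection from $S$ to $S'$. For $S_1,S_2\subseteq\mathbb{F}_2^n$, with $A:=\{\mathbf{v}0\mid\mathbf{v}\in S_1\}$ and $B:=\{\mathbf{0}_n0\}\cup\{\mathbf{v}1\mid\mathbf{v}\in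 S_2\setminus\{\mathbf{0}_n\}\}$ in $\mathbb{F}_2^{n+1}$ (juxtaposition = appending bits), \[S_1\diamond S_2:=\{\mathbf{w}00\mid \mathbf{w}\in A\cap B\}\cup\{\mathbf{w}01\mid \mathbf{w}\in A\setminus B\}\cup\{\mathbf{w}10\mid \mathbf{w}\in B\setminus A\}\cup\{\mathbf{w}11\mid \mathbf{w}\in\mathbb{F}_2^{n+1}\setminus(A\cup B)\}\subseteq\mathbb{F}_2^{n+3}.\] -}

module Defs where

open import Data.Nat using (ℕ; zero; suc; _^_)
open import Data.Bool using (Bool; true; false; not; _∧_; _∨_; _xor_; if_then_else_)
open import Data.Fin using (Fin)
open import Data.Vec using (Vec; []; _∷_; lookup; tabulate; replicate; zipWith; init; last; _[_]≔_; foldr)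
open import Data.List using (List; []; _∷_; concatMap; length; filterᵇ; map)
open import Data.Fin.Permutation using (Permutation′; _⟨$⟩ʳ_)
open import Data.Product using (Σ; ∃; _×_)
open import Relation.Binary.PropositionalEquality using (_≡_; _≢_)
open import Relation.Nullary using (¬_)

-- Vectors of F_2^n are Vec Bool n (false = 0, true = 1).
-- A subset S ⊆ F_2^n is given by its characteristic function.
BSet : ℕ → Set
BSet n = Vec Bool n → Bool

zeros : (n : ℕ) → Vec Bool n
zeros n = replicate n false

unit : {n : ℕ} → Fin n → Vec Bool n
unit {n} e = zeros n [ e ]≔ true

isZeroᵇ : {n : ℕ} → Vec Bool n → Bool
isZeroᵇ v = foldr _ (λ b acc → not b ∧ acc) true v

allVecs : (n : ℕ) → List (Vec Bool n)
allVecs zero = [] ∷ []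
allVecs (suc n) = concatMap (λ v → (false ∷ v) ∷ (true ∷ v) ∷ []) (allVecs n)

count : {n : ℕ} → (Vec Bool n → Bool) → ℕ
count {n} P = length (filterᵇ P (allVecs n))

size : {n : ℕ} → BSet n → ℕ
size S = count S

IsPowerOfTwo : ℕ → Set
IsPowerOfTwo m = ∃ λ k → m ≡ 2 ^ k

-- v is zero in all positions of X (X ⊆ [n] given as a Boolean vector)
zeroOnᵇ : {n : ℕ} → Vec Bool n → Vec Bool n → Bool
zeroOnᵇ X v = isZeroᵇ (zipWith _∧_ X v)

Powerful : {n : ℕ} → BSet n → Set
Powerful {n} S = (X : Vec Bool n) → IsPowerOfTwo (count (λ v → S v ∧ zeroOnᵇ X v))

IsLoop : {n : ℕ} → BSet n → Fin n → Set
IsLoop S e = ∀ v → S v ≡ true → lookup v e ≡ false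

IsFrame : {n : ℕ} → BSet n → Fin n → Set
IsFrame {n} S e =
  (S (zeros n) ≡ true) × (S (unit e) ≡ false) ×
  (∀ v → S v ≡ true → v ≢ zeros n → lookup v e ≡ true)

Loopless : {n : ℕ} → BSet n → Set
Loopless S = ∀ e → ¬ IsLoop S e

Frameless : {n : ℕ} → BSet n → Set
Frameless S = ∀ e → ¬ IsFrame S e

Linear : {n : ℕ} → BSet n → Set
Linear {n} S = (S (zeros n) ≡ true) ×
  (∀ u v → S u ≡ true → S v ≡ true → S (zipWith _xor_ u v) ≡ true)

permuteVec : {n : ℕ} → Permutation′ n → Vec Bool n → Vec Bool n
permuteVec σ v = tabulate (λ i → lookup v (σ ⟨$⟩ʳ i))

_≅_ : {n : ℕ} → BSet n → BSet n → Set
_≅_ {n} S T = Σ (Permutation′ n) λ σ → ∀ v → S v ≡ T (permuteVec σ v)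

_≐_ : {n : ℕ} → BSet n → BSet n → Set
S ≐ T = ∀ v → S v ≡ T v

-- A = { v0 | v ∈ S1 } ⊆ F_2^{n+1}   (appending a bit = last position)
Aᵇ : {n : ℕ} → BSet n → BSet (suc n)
Aᵇ S₁ w = not (last w) ∧ S₁ (init w)

-- B = { 0_n 0 } ∪ { v1 | v ∈ S2 \ {0_n} }
Bᵇ : {n : ℕ} → BSet n → BSet (suc n)
Bᵇ S₂ w = isZeroᵇ w ∨ (last w ∧ S₂ (init w) ∧ not (isZeroᵇ (init w)))

-- S1 ◇ S2 ⊆ F_2^{n+3}; for x = w b1 b2:
--   b1 b2 = 00 : w ∈ A ∩ B;  01 : w ∈ A \ B;  10 : w ∈ B \ A;  11 : w ∉ A ∪ B
_◇_ : {n : ℕ} → BSet n → BSet n → BSet (suc (suc (suc n)))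
(S₁ ◇ S₂) x = member (last (init x)) (last x)
  where
  w = init (init x)
  a = Aᵇ S₁ w
  b = Bᵇ S₂ w
  member : Bool → Bool → Bool
  member false false = a ∧ b
  member false true  = a ∧ not b
  member true  false = b ∧ not a
  member true  true  = not a ∧ not b

-- Write x ∈ 𝔽₂ⁿ⁺³ as w a b with w ∈ 𝔽₂ⁿ⁺¹. Then x ∈ S₁ ◇ S₂ iff a = [w ∉ A] and b = [w ∉ B], so S₁ ◇ S₂ is the
-- graph of a map on 𝔽₂ⁿ⁺¹ and counting over it is counting over 𝔽₂ⁿ⁺¹. This gives the size 2ⁿ⁺¹; and the vectors of
-- S₁ ◇ S₂ vanishing on X correspond to those of 𝔽₂ⁿ⁺¹, of A, of B or of A ∩ B = {0} vanishing on the rest of X,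
-- according to which of the two new positions X contains, so their number is a power of two.
-- A permutation of positions preserves how many vectors vanish at a position, or at a pair of positions. In S₁ ◇ S₂
-- these numbers are 2ⁿ at the positions of w and |S₁|, |S₂| < 2ⁿ at the two new ones. A zero at the first new
-- position forces a zero at the last position of w; by looplessness it forces none at the other positions of w, and a
-- zero at the second new position forces none at all. So an isomorphism fixes the three appended positions and
-- restricts to an isomorphism of both factors.
-- If S₁ ◇ S₂ were linear, the sum of its points over v1 and 01 would be v00c, which lies in S₁ ◇ S₂ only if v ∈ S₁.

module Submission where

open import Defs
open import Algebra.Bundles using (CommutativeMonoid)
open import Algebra.Properties.CommutativeSemigroup using (interchange)
import Algebra.Properties.CommutativeSemigroup as CommutativeSemigroupProperties
open import Data.Bool using (Bool; true; false; not; _∧_; _∨_; _xor_)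
open import Data.Bool.Properties
  using ( ∧-zeroʳ; ∧-identityʳ; ∨-identityʳ; ∧-assoc; ∧-comm; ∧-conicalʳ; ∧-commutativeMonoid
        ; not-involutive; xor-identityʳ; xor-inverseˡ)
import Data.Bool.Properties as Bool
open import Data.Empty using (⊥; ⊥-elim)
open import Data.Fin using (Fin; zero; suc; fromℕ; inject₁; punchIn)
open import Data.Fin.Permutation
  using (Permutation′; _⟨$⟩ʳ_; _⟨$⟩ˡ_; inverseˡ; flip; remove; punchIn-permute)
open import Data.Fin.Properties using (inject₁-injective; fromℕ≢inject₁)
open import Data.Fin.Relation.Unary.Top using (view; ‵fromℕ; ‵inj₁; ‵inject₁)
open import Data.List using (List; []; _∷_; map; filterᵇ; length; concatMap)
open import Data.List.Properties using (map-cong)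
open import Data.Nat using (ℕ; zero; suc; _+_; _^_; _∸_; _≤_; _<_; z≤n; s≤s)
open import Data.Nat.ListAction using (sum)
open import Data.Nat.Properties
  using ( +-assoc; +-identityʳ; +-commutativeSemigroup; m≤m+n; m<n+m; ≤-trans; ≤-reflexive
        ; <-≤-trans; ≤-<-trans; <⇒≢; n≢0⇒n>0; m^n>0; ^-monoʳ-<)
open import Data.Product using (∃; _×_; _,_; proj₁; proj₂)
open import Data.Sum using (_⊎_; inj₁; inj₂)
open import Data.Vec using (Vec; []; _∷_; _∷ʳ_; lookup; replicate; zipWith; init; last; initLast)
open import Data.Vec.Properties
  using ( ≡-dec; init-∷ʳ; last-∷ʳ; lookup-replicate; lookup∘tabulate; tabulate∘lookup; tabulate-cong
        ; zipWith-replicate₂; map-id)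
import Data.Vec.Properties as Vec
open import Function using (_∘_)
open import Function.Bundles using (mk⇔)
open import Relation.Binary.PropositionalEquality
open import Relation.Nullary using (¬_; Dec; does; yes; no; contradiction)
open import Relation.Nullary.Decidable using (does-⇔; dec-false)

open ≡-Reasoning

module ∧ = CommutativeSemigroupProperties (CommutativeMonoid.commutativeSemigroup ∧-commutativeMonoid)

-- Sums and counts over 𝔽₂ⁿ

𝟙 : Bool → ℕ
𝟙 true  = 1
𝟙 false = 0

∑ : {n : ℕ} → (Vec Bool n → ℕ) → ℕ
∑ {n} f = sum (map f (allVecs n))

_≟_ : {n : ℕ} (u v : Vec Bool n) → Dec (u ≡ v)
_≟_ = ≡-dec Bool._≟_

private
  sum-map-+ : {A : Set} (f g : A → ℕ) (xs : List A) →
              sum (map (λ x → f x + g x) xs) ≡ sum (map f xs) + sum (map g xs)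
  sum-map-+ f g []       = refl
  sum-map-+ f g (x ∷ xs) = begin
    f x + g x + sum (map (λ x → f x + g x) xs)    ≡⟨ cong (f x + g x +_) (sum-map-+ f g xs) ⟩
    f x + g x + (sum (map f xs) + sum (map g xs)) ≡⟨ interchange +-commutativeSemigroup (f x) (g x) _ _ ⟩
    sum (map f (x ∷ xs)) + sum (map g (x ∷ xs))   ∎

  sum-map-0 : {A : Set} (xs : List A) → sum (map (λ _ → 0) xs) ≡ 0
  sum-map-0 []       = refl
  sum-map-0 (x ∷ xs) = sum-map-0 xs

  sum-map-comm : {A B : Set} (f : A → B → ℕ) (xs : List A) (ys : List B) →
    sum (map (λ x → sum (map (f x) ys)) xs) ≡ sum (map (λ y → sum (map (λ x → f x y) xs)) ys)
  sum-map-comm f []       ys = sym (sum-map-0 ys)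
  sum-map-comm f (x ∷ xs) ys = begin
    sum (map (f x) ys) + sum (map (λ x → sum (map (f x) ys)) xs)
      ≡⟨ cong (sum (map (f x) ys) +_) (sum-map-comm f xs ys) ⟩
    sum (map (f x) ys) + sum (map (λ y → sum (map (λ x → f x y) xs)) ys)
      ≡⟨ sum-map-+ (f x) (λ y → sum (map (λ x → f x y) xs)) ys ⟨
    sum (map (λ y → f x y + sum (map (λ x → f x y) xs)) ys) ∎

  sum-map-concatMap : {n : ℕ} (f : Vec Bool (suc n) → ℕ) (xs : List (Vec Bool n)) →
    sum (map f (concatMap (λ v → (false ∷ v) ∷ (true ∷ v) ∷ []) xs))
      ≡ sum (map (λ v → f (false ∷ v)) xs) + sum (map (λ v → f (true ∷ v)) xs)
  sum-map-concatMap     f []       = refl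
  sum-map-concatMap {n} f (v ∷ xs) = begin
    f (false ∷ v) + (f (true ∷ v) + rest)
      ≡⟨ +-assoc (f (false ∷ v)) (f (true ∷ v)) rest ⟨
    f (false ∷ v) + f (true ∷ v) + rest
      ≡⟨ cong (f (false ∷ v) + f (true ∷ v) +_) (sum-map-concatMap f xs) ⟩
    f (false ∷ v) + f (true ∷ v) + (sum (map f₀ xs) + sum (map f₁ xs))
      ≡⟨ interchange +-commutativeSemigroup (f (false ∷ v)) (f (true ∷ v)) _ _ ⟩
    sum (map f₀ (v ∷ xs)) + sum (map f₁ (v ∷ xs)) ∎
    where
    rest : ℕ
    rest = sum (map f (concatMap (λ v → (false ∷ v) ∷ (true ∷ v) ∷ []) xs))
    f₀ f₁ : Vec Bool n → ℕ
    f₀ v = f (false ∷ v)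
    f₁ v = f (true ∷ v)

  length-filterᵇ : {A : Set} (P : A → Bool) (xs : List A) →
                   length (filterᵇ P xs) ≡ sum (map (λ x → 𝟙 (P x)) xs)
  length-filterᵇ P []       = refl
  length-filterᵇ P (x ∷ xs) with P x
  ... | true  = cong suc (length-filterᵇ P xs)
  ... | false = length-filterᵇ P xs

module _ {n : ℕ} where

  ∑-cong : {f g : Vec Bool n → ℕ} → (∀ v → f v ≡ g v) → ∑ f ≡ ∑ g
  ∑-cong f≗g = cong sum (map-cong f≗g (allVecs n))

  ∑-+ : (f g : Vec Bool n → ℕ) → ∑ (λ v → f v + g v) ≡ ∑ f + ∑ g
  ∑-+ f g = sum-map-+ f g (allVecs n)

  ∑-comm : (f : Vec Bool n → Vec Bool n → ℕ) → ∑ (λ u → ∑ (f u)) ≡ ∑ (λ v → ∑ (λ u → f u v))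
  ∑-comm f = sum-map-comm f (allVecs n) (allVecs n)

  count≡∑ : (P : Vec Bool n → Bool) → count P ≡ ∑ (λ v → 𝟙 (P v))
  count≡∑ P = length-filterᵇ P (allVecs n)

∑-∷ : {n : ℕ} (f : Vec Bool (suc n) → ℕ) → ∑ f ≡ ∑ (λ v → f (false ∷ v)) + ∑ (λ v → f (true ∷ v))
∑-∷ {n} f = sum-map-concatMap f (allVecs n)

module _ {n : ℕ} where

  count-cong : {P Q : Vec Bool n → Bool} → (∀ v → P v ≡ Q v) → count P ≡ count Q
  count-cong {P} {Q} P≗Q = begin
    count P            ≡⟨ count≡∑ P ⟩
    ∑ (λ v → 𝟙 (P v))  ≡⟨ ∑-cong (λ v → cong 𝟙 (P≗Q v)) ⟩
    ∑ (λ v → 𝟙 (Q v))  ≡⟨ count≡∑ Q ⟨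
    count Q            ∎

  count-split : (P R : Vec Bool n → Bool) →
                count P ≡ count (λ v → P v ∧ R v) + count (λ v → P v ∧ not (R v))
  count-split P R = begin
    count P
      ≡⟨ count≡∑ P ⟩
    ∑ (λ v → 𝟙 (P v))
      ≡⟨ ∑-cong (λ v → 𝟙-split (P v) (R v)) ⟩
    ∑ (λ v → 𝟙 (P v ∧ R v) + 𝟙 (P v ∧ not (R v)))
      ≡⟨ ∑-+ (λ v → 𝟙 (P v ∧ R v)) (λ v → 𝟙 (P v ∧ not (R v))) ⟩
    ∑ (λ v → 𝟙 (P v ∧ R v)) + ∑ (λ v → 𝟙 (P v ∧ not (R v)))
      ≡⟨ cong₂ _+_ (count≡∑ (λ v → P v ∧ R v)) (count≡∑ (λ v → P v ∧ not (R v))) ⟨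
    count (λ v → P v ∧ R v) + count (λ v → P v ∧ not (R v)) ∎
    where
    𝟙-split : ∀ a b → 𝟙 a ≡ 𝟙 (a ∧ b) + 𝟙 (a ∧ not b)
    𝟙-split false b     = refl
    𝟙-split true  false = refl
    𝟙-split true  true  = refl

  count-∧-≤ : (P R : Vec Bool n → Bool) → count (λ v → P v ∧ R v) ≤ count P
  count-∧-≤ P R = ≤-trans (m≤m+n _ _) (≤-reflexive (sym (count-split P R)))

count-∷ : {n : ℕ} (P : Vec Bool (suc n) → Bool) →
          count P ≡ count (λ v → P (false ∷ v)) + count (λ v → P (true ∷ v))
count-∷ P = begin
  count P
    ≡⟨ count≡∑ P ⟩
  ∑ (λ v → 𝟙 (P v))
    ≡⟨ ∑-∷ (λ v → 𝟙 (P v)) ⟩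
  ∑ (λ v → 𝟙 (P (false ∷ v))) + ∑ (λ v → 𝟙 (P (true ∷ v)))
    ≡⟨ cong₂ _+_ (count≡∑ (λ v → P (false ∷ v))) (count≡∑ (λ v → P (true ∷ v))) ⟨
  count (λ v → P (false ∷ v)) + count (λ v → P (true ∷ v)) ∎

count-∷ʳ : {n : ℕ} (P : Vec Bool (suc n) → Bool) →
           count P ≡ count (λ v → P (v ∷ʳ false)) + count (λ v → P (v ∷ʳ true))
count-∷ʳ {zero}  P = trans (count-∷ P) (cong₂ _+_ (at-last false) (at-last true))
  where
  at-last : (b : Bool) → count (λ v → P (b ∷ v)) ≡ count (λ v → P (v ∷ʳ b))
  at-last b = count-cong {P = λ v → P (b ∷ v)} {Q = λ v → P (v ∷ʳ b)} λ { [] → refl }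
count-∷ʳ {suc n} P = begin
  count P
    ≡⟨ count-∷ P ⟩
  count (λ v → P (false ∷ v)) + count (λ v → P (true ∷ v))
    ≡⟨ cong₂ _+_ (count-∷ʳ (λ v → P (false ∷ v))) (count-∷ʳ (λ v → P (true ∷ v))) ⟩
  (count (λ v → P (false ∷ (v ∷ʳ false))) + count (λ v → P (false ∷ (v ∷ʳ true))))
    + (count (λ v → P (true ∷ (v ∷ʳ false))) + count (λ v → P (true ∷ (v ∷ʳ true))))
    ≡⟨ interchange +-commutativeSemigroup (count (λ v → P (false ∷ (v ∷ʳ false)))) _ _ _ ⟩
  (count (λ v → P (false ∷ (v ∷ʳ false))) + count (λ v → P (true ∷ (v ∷ʳ false))))
    + (count (λ v → P (false ∷ (v ∷ʳ true))) + count (λ v → P (true ∷ (v ∷ʳ true))))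
    ≡⟨ cong₂ _+_ (count-∷ (λ v → P (v ∷ʳ false))) (count-∷ (λ v → P (v ∷ʳ true))) ⟨
  count (λ v → P (v ∷ʳ false)) + count (λ v → P (v ∷ʳ true)) ∎

count-false : {n : ℕ} → count {n} (λ _ → false) ≡ 0
count-false {zero}  = refl
count-false {suc n} = trans (count-∷ {n} (λ _ → false)) (cong₂ _+_ (count-false {n}) (count-false {n}))

^-double : (n : ℕ) → 2 ^ n + 2 ^ n ≡ 2 ^ suc n
^-double n = cong (2 ^ n +_) (sym (+-identityʳ (2 ^ n)))

count-true : {n : ℕ} → count {n} (λ _ → true) ≡ 2 ^ n
count-true {zero}  = refl
count-true {suc n} = begin
  count {suc n} (λ _ → true)                       ≡⟨ count-∷ {n} (λ _ → true) ⟩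
  count {n} (λ _ → true) + count {n} (λ _ → true)  ≡⟨ cong₂ _+_ (count-true {n}) (count-true {n}) ⟩
  2 ^ n + 2 ^ n                                    ≡⟨ ^-double n ⟩
  2 ^ suc n                                        ∎

count-≟ : {n : ℕ} (c : Vec Bool n) → count (λ u → does (u ≟ c)) ≡ 1
count-≟         []          = refl
count-≟ {suc n} (false ∷ c) =
  trans (count-∷ (λ u → does (u ≟ (false ∷ c)))) (cong₂ _+_ (count-≟ c) (count-false {n}))
count-≟ {suc n} (true ∷ c)  =
  trans (count-∷ (λ u → does (u ≟ (true ∷ c)))) (cong₂ _+_ (count-false {n}) (count-≟ c))

module _ {n : ℕ} where

  count-∧-≟ : (P : Vec Bool n → Bool) (c : Vec Bool n) → count (λ u → P u ∧ does (u ≟ c)) ≡ 𝟙 (P c)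
  count-∧-≟ P c = trans (count-cong at-c) (constant (P c))
    where
    at-c : ∀ u → P u ∧ does (u ≟ c) ≡ P c ∧ does (u ≟ c)
    at-c u with u ≟ c
    ... | yes refl = refl
    ... | no  _    = trans (∧-zeroʳ (P u)) (sym (∧-zeroʳ (P c)))
    constant : ∀ b → count (λ u → b ∧ does (u ≟ c)) ≡ 𝟙 b
    constant true  = count-≟ c
    constant false = count-false {n}

  count-pos : (P : Vec Bool n → Bool) {v : Vec Bool n} → P v ≡ true → 0 < count P
  count-pos P {v} Pv =
    ≤-trans (≤-reflexive (sym (trans (count-∧-≟ P v) (cong 𝟙 Pv)))) (count-∧-≤ P (λ u → does (u ≟ v)))

  -- Fubini: sum ⟦u = g v⟧ over both variables and swap, using u = g v ⇔ v = h u.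
  count-∘-inverse : (P : Vec Bool n → Bool) (g h : Vec Bool n → Vec Bool n) →
                    (∀ v → h (g v) ≡ v) → (∀ u → g (h u) ≡ u) → count (λ v → P (g v)) ≡ count P
  count-∘-inverse P g h hg gh = begin
    count (λ v → P (g v))
      ≡⟨ count≡∑ (λ v → P (g v)) ⟩
    ∑ (λ v → 𝟙 (P (g v)))
      ≡⟨ ∑-cong (λ v → trans (sym (count-∧-≟ P (g v))) (count≡∑ (λ u → P u ∧ does (u ≟ g v)))) ⟩
    ∑ (λ v → ∑ (λ u → 𝟙 (P u ∧ does (u ≟ g v))))
      ≡⟨ ∑-comm (λ v u → 𝟙 (P u ∧ does (u ≟ g v))) ⟩
    ∑ (λ u → ∑ (λ v → 𝟙 (P u ∧ does (u ≟ g v))))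
      ≡⟨ ∑-cong (λ u → ∑-cong (λ v → cong (λ b → 𝟙 (P u ∧ b)) (≟-transpose u v))) ⟩
    ∑ (λ u → ∑ (λ v → 𝟙 (P u ∧ does (v ≟ h u))))
      ≡⟨ ∑-cong (λ u → trans (sym (count≡∑ (λ v → P u ∧ does (v ≟ h u)))) (count-∧-≟ (λ _ → P u) (h u))) ⟩
    ∑ (λ u → 𝟙 (P u))
      ≡⟨ count≡∑ P ⟨
    count P ∎
    where
    ≟-transpose : ∀ u v → does (u ≟ g v) ≡ does (v ≟ h u)
    ≟-transpose u v = does-⇔ (mk⇔ (λ u≡gv → trans (sym (hg v)) (cong h (sym u≡gv)))
                                   (λ v≡hu → trans (sym (gh u)) (cong g (sym v≡hu))))
                              (u ≟ g v) (v ≟ h u)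

-- Vectors built by appending bits

lookup-∷ʳ-inject₁ : {n : ℕ} (v : Vec Bool n) (a : Bool) (i : Fin n) → lookup (v ∷ʳ a) (inject₁ i) ≡ lookup v i
lookup-∷ʳ-inject₁ (x ∷ v) a zero    = refl
lookup-∷ʳ-inject₁ (x ∷ v) a (suc i) = lookup-∷ʳ-inject₁ v a i

lookup-∷ʳ-fromℕ : {n : ℕ} (v : Vec Bool n) (a : Bool) → lookup (v ∷ʳ a) (fromℕ n) ≡ a
lookup-∷ʳ-fromℕ []      a = refl
lookup-∷ʳ-fromℕ (x ∷ v) a = lookup-∷ʳ-fromℕ v a

replicate-∷ʳ : (n : ℕ) (x : Bool) → replicate n x ∷ʳ x ≡ replicate (suc n) x
replicate-∷ʳ zero    x = refl
replicate-∷ʳ (suc n) x = cong (x ∷_) (replicate-∷ʳ n x)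

zipWith-∷ʳ : {n : ℕ} (f : Bool → Bool → Bool) (u v : Vec Bool n) (a b : Bool) →
             zipWith f (u ∷ʳ a) (v ∷ʳ b) ≡ zipWith f u v ∷ʳ f a b
zipWith-∷ʳ f []      []      a b = refl
zipWith-∷ʳ f (x ∷ u) (y ∷ v) a b = cong (f x y ∷_) (zipWith-∷ʳ f u v a b)

xor-zeros : {n : ℕ} (v : Vec Bool n) → zipWith _xor_ v (zeros n) ≡ v
xor-zeros v = trans (zipWith-replicate₂ _xor_ v false) (trans (Vec.map-cong xor-identityʳ v) (map-id v))

isZeroᵇ-zeros : (n : ℕ) → isZeroᵇ (zeros n) ≡ true
isZeroᵇ-zeros zero    = refl
isZeroᵇ-zeros (suc n) = isZeroᵇ-zeros n

isZeroᵇ≡true⇒≡zeros : {n : ℕ} (v : Vec Bool n) → isZeroᵇ v ≡ true → v ≡ zeros n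
isZeroᵇ≡true⇒≡zeros []          _   = refl
isZeroᵇ≡true⇒≡zeros (false ∷ v) v≡0 = cong (false ∷_) (isZeroᵇ≡true⇒≡zeros v v≡0)

isZeroᵇ≡does : {n : ℕ} (v : Vec Bool n) → isZeroᵇ v ≡ does (v ≟ zeros n)
isZeroᵇ≡does []          = refl
isZeroᵇ≡does (false ∷ v) = isZeroᵇ≡does v
isZeroᵇ≡does (true ∷ v)  = refl

isZeroᵇ-∷ʳ : {n : ℕ} (u : Vec Bool n) (c : Bool) → isZeroᵇ (u ∷ʳ c) ≡ isZeroᵇ u ∧ not c
isZeroᵇ-∷ʳ []      c = ∧-identityʳ (not c)
isZeroᵇ-∷ʳ (a ∷ u) c = trans (cong (not a ∧_) (isZeroᵇ-∷ʳ u c)) (sym (∧-assoc (not a) (isZeroᵇ u) (not c)))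

lookup≡true⇒≢zeros : {n : ℕ} (v : Vec Bool n) (i : Fin n) → lookup v i ≡ true → v ≢ zeros n
lookup≡true⇒≢zeros v i vᵢ≡true refl with trans (sym vᵢ≡true) (lookup-replicate i false)
... | ()

lookup≡true⇒isZeroᵇ≡false : {n : ℕ} (v : Vec Bool n) (i : Fin n) → lookup v i ≡ true → isZeroᵇ v ≡ false
lookup≡true⇒isZeroᵇ≡false v i vᵢ≡true =
  trans (isZeroᵇ≡does v) (dec-false (v ≟ zeros _) (lookup≡true⇒≢zeros v i vᵢ≡true))

zeroOnᵇ-zeros : {n : ℕ} (X : Vec Bool n) → zeroOnᵇ X (zeros n) ≡ true
zeroOnᵇ-zeros []          = refl
zeroOnᵇ-zeros (false ∷ X) = zeroOnᵇ-zeros X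
zeroOnᵇ-zeros (true ∷ X)  = zeroOnᵇ-zeros X

zeroOnᵇ-ones : {n : ℕ} (v : Vec Bool n) → zeroOnᵇ (replicate n true) v ≡ isZeroᵇ v
zeroOnᵇ-ones []      = refl
zeroOnᵇ-ones (x ∷ v) = cong (not x ∧_) (zeroOnᵇ-ones v)

zeroOnᵇ-∷ʳ : {n : ℕ} (X v : Vec Bool n) (x b : Bool) → zeroOnᵇ (X ∷ʳ x) (v ∷ʳ b) ≡ zeroOnᵇ X v ∧ not (x ∧ b)
zeroOnᵇ-∷ʳ []      []      x b = ∧-identityʳ _
zeroOnᵇ-∷ʳ (y ∷ X) (c ∷ v) x b =
  trans (cong (not (y ∧ c) ∧_) (zeroOnᵇ-∷ʳ X v x b)) (sym (∧-assoc (not (y ∧ c)) (zeroOnᵇ X v) _))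

zeroOnᵇ-∷ʳ-false : {n : ℕ} (X : Vec Bool (suc n)) (u : Vec Bool n) → zeroOnᵇ X (u ∷ʳ false) ≡ zeroOnᵇ (init X) u
zeroOnᵇ-∷ʳ-false X u with initLast X
... | Y , y , refl =
  trans (zeroOnᵇ-∷ʳ Y u y false) (trans (cong (λ b → zeroOnᵇ Y u ∧ not b) (∧-zeroʳ y)) (∧-identityʳ _))

zeroOnᵇ-∷ʳ-true : {n : ℕ} (X : Vec Bool (suc n)) (u : Vec Bool n) →
                  zeroOnᵇ X (u ∷ʳ true) ≡ zeroOnᵇ (init X) u ∧ not (last X)
zeroOnᵇ-∷ʳ-true X u with initLast X
... | Y , y , refl = trans (zeroOnᵇ-∷ʳ Y u y true) (cong (λ b → zeroOnᵇ Y u ∧ not b) (∧-identityʳ y))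

count-∧-isZeroᵇ : {n : ℕ} (P : Vec Bool n → Bool) → count (λ v → P v ∧ isZeroᵇ v) ≡ 𝟙 (P (zeros n))
count-∧-isZeroᵇ {n} P = trans (count-cong (λ v → cong (P v ∧_) (isZeroᵇ≡does v))) (count-∧-≟ P (zeros n))

count-split-zeros : {n : ℕ} (P : Vec Bool n → Bool) →
                    count P ≡ 𝟙 (P (zeros n)) + count (λ v → P v ∧ not (isZeroᵇ v))
count-split-zeros P =
  trans (count-split P isZeroᵇ) (cong (_+ count (λ v → P v ∧ not (isZeroᵇ v))) (count-∧-isZeroᵇ P))

count-not-lookup : {n : ℕ} (j : Fin (suc n)) → count (λ w → not (lookup w j)) ≡ 2 ^ n
count-not-lookup {n} zero = begin
  count {suc n} (λ w → not (lookup w zero))         ≡⟨ count-∷ {n} (λ w → not (lookup w zero)) ⟩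
  count {n} (λ _ → true) + count {n} (λ _ → false)  ≡⟨ cong₂ _+_ (count-true {n}) (count-false {n}) ⟩
  2 ^ n + 0                                         ≡⟨ +-identityʳ (2 ^ n) ⟩
  2 ^ n                                             ∎
count-not-lookup {suc n} (suc j) = begin
  count {suc (suc n)} (λ w → not (lookup w (suc j)))
    ≡⟨ count-∷ {suc n} (λ w → not (lookup w (suc j))) ⟩
  count (λ w → not (lookup w j)) + count (λ w → not (lookup w j))
    ≡⟨ cong₂ _+_ (count-not-lookup j) (count-not-lookup j) ⟩
  2 ^ n + 2 ^ n
    ≡⟨ ^-double n ⟩
  2 ^ suc n ∎

count-zeroOnᵇ : {n : ℕ} (X : Vec Bool n) → IsPowerOfTwo (count (zeroOnᵇ X))
count-zeroOnᵇ []          = 0 , refl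
count-zeroOnᵇ (false ∷ X) with count-zeroOnᵇ X
... | k , count≡2^k = suc k , (begin
  count (zeroOnᵇ (false ∷ X))            ≡⟨ count-∷ (zeroOnᵇ (false ∷ X)) ⟩
  count (zeroOnᵇ X) + count (zeroOnᵇ X)  ≡⟨ cong₂ _+_ count≡2^k count≡2^k ⟩
  2 ^ k + 2 ^ k                          ≡⟨ ^-double k ⟩
  2 ^ suc k                              ∎)
count-zeroOnᵇ {suc n} (true ∷ X) with count-zeroOnᵇ X
... | k , count≡2^k = k , (begin
  count (zeroOnᵇ (true ∷ X))                   ≡⟨ count-∷ (zeroOnᵇ (true ∷ X)) ⟩
  count (zeroOnᵇ X) + count {n} (λ _ → false)  ≡⟨ cong₂ _+_ count≡2^k (count-false {n}) ⟩
  2 ^ k + 0                                    ≡⟨ +-identityʳ (2 ^ k) ⟩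
  2 ^ k                                        ∎)

-- Permutations of positions

lookup-ext : {n : ℕ} {u v : Vec Bool n} → (∀ i → lookup u i ≡ lookup v i) → u ≡ v
lookup-ext {u = u} {v} u≗v = trans (sym (tabulate∘lookup u)) (trans (tabulate-cong u≗v) (tabulate∘lookup v))

module _ {n : ℕ} where

  lookup-permuteVec : (σ : Permutation′ n) (v : Vec Bool n) (i : Fin n) →
                      lookup (permuteVec σ v) i ≡ lookup v (σ ⟨$⟩ʳ i)
  lookup-permuteVec σ v = lookup∘tabulate (λ i → lookup v (σ ⟨$⟩ʳ i))

  permuteVec-flip : (σ : Permutation′ n) (v : Vec Bool n) → permuteVec σ (permuteVec (flip σ) v) ≡ v
  permuteVec-flip σ v = lookup-ext λ i → begin
    lookup (permuteVec σ (permuteVec (flip σ) v)) i  ≡⟨ lookup-permuteVec σ (permuteVec (flip σ) v) i ⟩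
    lookup (permuteVec (flip σ) v) (σ ⟨$⟩ʳ i)        ≡⟨ lookup-permuteVec (flip σ) v _ ⟩
    lookup v (σ ⟨$⟩ˡ (σ ⟨$⟩ʳ i))                     ≡⟨ cong (lookup v) (inverseˡ σ) ⟩
    lookup v i                                       ∎

  permuteVec-zeros : (σ : Permutation′ n) → permuteVec σ (zeros n) ≡ zeros n
  permuteVec-zeros σ = lookup-ext λ i →
    trans (lookup-permuteVec σ (zeros n) i)
          (trans (lookup-replicate (σ ⟨$⟩ʳ i) false) (sym (lookup-replicate i false)))

  isZeroᵇ-permuteVec : (σ : Permutation′ n) (v : Vec Bool n) → isZeroᵇ (permuteVec σ v) ≡ isZeroᵇ v
  isZeroᵇ-permuteVec σ v = begin
    isZeroᵇ (permuteVec σ v)         ≡⟨ isZeroᵇ≡does (permuteVec σ v) ⟩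
    does (permuteVec σ v ≟ zeros n)  ≡⟨ does-⇔ (mk⇔ from to) (permuteVec σ v ≟ zeros n) (v ≟ zeros n) ⟩
    does (v ≟ zeros n)               ≡⟨ isZeroᵇ≡does v ⟨
    isZeroᵇ v                        ∎
    where
    from : permuteVec σ v ≡ zeros n → v ≡ zeros n
    from σv≡0 = begin
      v                                     ≡⟨ permuteVec-flip (flip σ) v ⟨
      permuteVec (flip σ) (permuteVec σ v)  ≡⟨ cong (permuteVec (flip σ)) σv≡0 ⟩
      permuteVec (flip σ) (zeros n)         ≡⟨ permuteVec-zeros (flip σ) ⟩
      zeros n                               ∎
    to : v ≡ zeros n → permuteVec σ v ≡ zeros n
    to refl = permuteVec-zeros σ

punchIn-fromℕ : {n : ℕ} (i : Fin n) → punchIn (fromℕ n) i ≡ inject₁ i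
punchIn-fromℕ zero    = refl
punchIn-fromℕ (suc i) = cong suc (punchIn-fromℕ i)

module _ {n : ℕ} (σ : Permutation′ (suc n)) (σ-top : σ ⟨$⟩ʳ fromℕ n ≡ fromℕ n) where

  inject₁-remove-fromℕ : (i : Fin n) → inject₁ (remove (fromℕ n) σ ⟨$⟩ʳ i) ≡ σ ⟨$⟩ʳ inject₁ i
  inject₁-remove-fromℕ i = begin
    inject₁ (remove (fromℕ n) σ ⟨$⟩ʳ i)                  ≡⟨ punchIn-fromℕ _ ⟨
    punchIn (fromℕ n) (remove (fromℕ n) σ ⟨$⟩ʳ i)        ≡⟨ cong (λ t → punchIn t (remove (fromℕ n) σ ⟨$⟩ʳ i)) σ-top ⟨
    punchIn (σ ⟨$⟩ʳ fromℕ n) (remove (fromℕ n) σ ⟨$⟩ʳ i)  ≡⟨ punchIn-permute σ (fromℕ n) i ⟨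
    σ ⟨$⟩ʳ punchIn (fromℕ n) i                           ≡⟨ cong (σ ⟨$⟩ʳ_) (punchIn-fromℕ i) ⟩
    σ ⟨$⟩ʳ inject₁ i                                     ∎

  remove-fromℕ-fixes : {i : Fin n} → σ ⟨$⟩ʳ inject₁ i ≡ inject₁ i → remove (fromℕ n) σ ⟨$⟩ʳ i ≡ i
  remove-fromℕ-fixes {i} σ-fixes-i = inject₁-injective (trans (inject₁-remove-fromℕ i) σ-fixes-i)

  permuteVec-∷ʳ : (v : Vec Bool n) (a : Bool) → permuteVec σ (v ∷ʳ a) ≡ permuteVec (remove (fromℕ n) σ) v ∷ʳ a
  permuteVec-∷ʳ v a = lookup-ext at
    where
    ρ : Permutation′ n
    ρ = remove (fromℕ n) σ
    at : ∀ k → lookup (permuteVec σ (v ∷ʳ a)) k ≡ lookup (permuteVec ρ v ∷ʳ a) k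
    at k with view k
    ... | ‵fromℕ = begin
      lookup (permuteVec σ (v ∷ʳ a)) (fromℕ n)  ≡⟨ lookup-permuteVec σ (v ∷ʳ a) (fromℕ n) ⟩
      lookup (v ∷ʳ a) (σ ⟨$⟩ʳ fromℕ n)          ≡⟨ cong (lookup (v ∷ʳ a)) σ-top ⟩
      lookup (v ∷ʳ a) (fromℕ n)                 ≡⟨ lookup-∷ʳ-fromℕ v a ⟩
      a                                         ≡⟨ lookup-∷ʳ-fromℕ (permuteVec ρ v) a ⟨
      lookup (permuteVec ρ v ∷ʳ a) (fromℕ n)    ∎
    ... | ‵inject₁ i = begin
      lookup (permuteVec σ (v ∷ʳ a)) (inject₁ i)  ≡⟨ lookup-permuteVec σ (v ∷ʳ a) (inject₁ i) ⟩
      lookup (v ∷ʳ a) (σ ⟨$⟩ʳ inject₁ i)          ≡⟨ cong (lookup (v ∷ʳ a)) (inject₁-remove-fromℕ i) ⟨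
      lookup (v ∷ʳ a) (inject₁ (ρ ⟨$⟩ʳ i))        ≡⟨ lookup-∷ʳ-inject₁ v a (ρ ⟨$⟩ʳ i) ⟩
      lookup v (ρ ⟨$⟩ʳ i)                         ≡⟨ lookup-permuteVec ρ v i ⟨
      lookup (permuteVec ρ v) i                   ≡⟨ lookup-∷ʳ-inject₁ (permuteVec ρ v) a i ⟨
      lookup (permuteVec ρ v ∷ʳ a) (inject₁ i)    ∎

-- Powerful, loopless and frameless sets

module _ {n : ℕ} {S : BSet n} where

  Powerful⇒zeros∈ : Powerful S → S (zeros n) ≡ true
  Powerful⇒zeros∈ S-powerful with S (zeros n) in S0 | S-powerful (replicate n true)
  ... | true  | _              = refl
  ... | false | k , count≡2^k = contradiction (trans (sym count≡0) count≡2^k) (<⇒≢ (m^n>0 2 k))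
    where
    count≡0 : count (λ v → S v ∧ zeroOnᵇ (replicate n true) v) ≡ 0
    count≡0 = begin
      count (λ v → S v ∧ zeroOnᵇ (replicate n true) v)  ≡⟨ count-cong (λ v → cong (S v ∧_) (zeroOnᵇ-ones v)) ⟩
      count (λ v → S v ∧ isZeroᵇ v)                     ≡⟨ count-∧-isZeroᵇ S ⟩
      𝟙 (S (zeros n))                                   ≡⟨ cong 𝟙 S0 ⟩
      0                                                 ∎

  count-lookup-pos : {i : Fin n} → ¬ IsLoop S i → 0 < count (λ v → S v ∧ lookup v i)
  count-lookup-pos {i} no-loop = n≢0⇒n>0 (λ count≡0 → no-loop (loop count≡0))
    where
    loop : count (λ v → S v ∧ lookup v i) ≡ 0 → IsLoop S i
    loop count≡0 v Sv with lookup v i in vᵢ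
    ... | false = refl
    ... | true  = contradiction (sym count≡0) (<⇒≢ (count-pos (λ v → S v ∧ lookup v i) (cong₂ _∧_ Sv vᵢ)))

  count-not-lookup< : {i : Fin n} → ¬ IsLoop S i → count (λ v → S v ∧ not (lookup v i)) < size S
  count-not-lookup< {i} no-loop =
    <-≤-trans (m<n+m _ (count-lookup-pos no-loop)) (≤-reflexive (sym (count-split S (λ v → lookup v i))))

1<size : {n : ℕ} {S : BSet (suc n)} → Loopless S → S (zeros (suc n)) ≡ true → 1 < size S
1<size {n} {S} S-loopless S0 = ≤-<-trans 1≤count (count-not-lookup< (S-loopless zero))
  where
  1≤count : 1 ≤ count (λ v → S v ∧ not (lookup v zero))
  1≤count = count-pos (λ v → S v ∧ not (lookup v zero)) (cong (_∧ true) S0)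

IsLoop-intro : {n : ℕ} {S : BSet n} {i : Fin n} → (∀ u → S u ≡ true → lookup u i ≡ true → ⊥) → IsLoop S i
IsLoop-intro {i = i} no-one u Su with lookup u i in uᵢ
... | false = refl
... | true  = ⊥-elim (no-one u Su uᵢ)

IsFrame-nonzero : {n : ℕ} {D : BSet n} {e : Fin n} → IsFrame D e →
                  (v : Vec Bool n) → D v ≡ true → (k : Fin n) → lookup v k ≡ true → lookup v e ≡ false → ⊥
IsFrame-nonzero (_ , _ , nonzero⇒vₑ) v Dv k vₖ≡true vₑ≡false
  with trans (sym vₑ≡false) (nonzero⇒vₑ v Dv (lookup≡true⇒≢zeros v k vₖ≡true))
... | ()

-- S₁ ◇ S₂ as a graph over 𝔽₂ⁿ⁺¹

count-graph : {n : ℕ} (f : Vec Bool n → Bool) (P : Vec Bool (suc n) → Bool) →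
              count (λ x → (last x xor f (init x)) ∧ P x) ≡ count (λ w → P (w ∷ʳ not (f w)))
count-graph {n} f P = begin
  count (λ x → (last x xor f (init x)) ∧ P x)
    ≡⟨ count-∷ʳ (λ x → (last x xor f (init x)) ∧ P x) ⟩
  count (on-sheet false) + count (on-sheet true)
    ≡⟨ cong₂ _+_ (count-cong sheet₀) (count-cong sheet₁) ⟩
  count (λ w → P (w ∷ʳ not (f w)) ∧ f w) + count (λ w → P (w ∷ʳ not (f w)) ∧ not (f w))
    ≡⟨ count-split (λ w → P (w ∷ʳ not (f w))) f ⟨
  count (λ w → P (w ∷ʳ not (f w))) ∎
  where
  on-sheet : Bool → Vec Bool n → Bool
  on-sheet b w = (last (w ∷ʳ b) xor f (init (w ∷ʳ b))) ∧ P (w ∷ʳ b)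
  sheet₀ : ∀ w → on-sheet false w ≡ P (w ∷ʳ not (f w)) ∧ f w
  sheet₀ w rewrite init-∷ʳ false w | last-∷ʳ false w with f w
  ... | true  = sym (∧-identityʳ _)
  ... | false = sym (∧-zeroʳ _)
  sheet₁ : ∀ w → on-sheet true w ≡ P (w ∷ʳ not (f w)) ∧ not (f w)
  sheet₁ w rewrite init-∷ʳ true w | last-∷ʳ true w with f w
  ... | true  = sym (∧-zeroʳ _)
  ... | false = sym (∧-identityʳ _)

module _ {n : ℕ} (S₁ S₂ : BSet n) where

  ◇-xor : (x : Vec Bool (suc (suc (suc n)))) →
          (S₁ ◇ S₂) x ≡ (last x xor Bᵇ S₂ (init (init x))) ∧ (last (init x) xor Aᵇ S₁ (init (init x)))
  ◇-xor x with last (init x) | last x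
  ... | false | false = ∧-comm (Aᵇ S₁ (init (init x))) _
  ... | false | true  = ∧-comm (Aᵇ S₁ (init (init x))) _
  ... | true  | false = refl
  ... | true  | true  = ∧-comm (not (Aᵇ S₁ (init (init x)))) _

  ◇-∷ʳ : (w : Vec Bool (suc n)) (a b : Bool) → (S₁ ◇ S₂) ((w ∷ʳ a) ∷ʳ b) ≡ (b xor Bᵇ S₂ w) ∧ (a xor Aᵇ S₁ w)
  ◇-∷ʳ w a b rewrite ◇-xor ((w ∷ʳ a) ∷ʳ b) | init-∷ʳ b (w ∷ʳ a) | last-∷ʳ b (w ∷ʳ a)
                   | init-∷ʳ a w | last-∷ʳ a w = refl

  ◇-point : Vec Bool (suc n) → Vec Bool (suc (suc (suc n)))
  ◇-point w = (w ∷ʳ not (Aᵇ S₁ w)) ∷ʳ not (Bᵇ S₂ w)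

  ◇-point∈◇ : (w : Vec Bool (suc n)) → (S₁ ◇ S₂) (◇-point w) ≡ true
  ◇-point∈◇ w = trans (◇-∷ʳ w (not (Aᵇ S₁ w)) (not (Bᵇ S₂ w)))
                      (cong₂ _∧_ (xor-inverseˡ (Bᵇ S₂ w)) (xor-inverseˡ (Aᵇ S₁ w)))

  count-◇ : (Q : Vec Bool (suc (suc (suc n))) → Bool) →
            count (λ x → (S₁ ◇ S₂) x ∧ Q x) ≡ count (λ w → Q (◇-point w))
  count-◇ Q = begin
    count (λ x → (S₁ ◇ S₂) x ∧ Q x)
      ≡⟨ count-cong (λ x → trans (cong (_∧ Q x) (◇-xor x)) (∧-assoc (last x xor B (init x)) _ (Q x))) ⟩
    count (λ x → (last x xor B (init x)) ∧ ((last (init x) xor Aᵇ S₁ (init (init x))) ∧ Q x))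
      ≡⟨ count-graph B (λ x → (last (init x) xor Aᵇ S₁ (init (init x))) ∧ Q x) ⟩
    count (λ y → (last (init (y ∷ʳ b y)) xor Aᵇ S₁ (init (init (y ∷ʳ b y)))) ∧ Q (y ∷ʳ b y))
      ≡⟨ count-cong (λ y → cong (λ z → (last z xor Aᵇ S₁ (init z)) ∧ Q (y ∷ʳ b y)) (init-∷ʳ (b y) y)) ⟩
    count (λ y → (last y xor Aᵇ S₁ (init y)) ∧ Q (y ∷ʳ b y))
      ≡⟨ count-graph (Aᵇ S₁) (λ y → Q (y ∷ʳ b y)) ⟩
    count (λ w → Q ((w ∷ʳ not (Aᵇ S₁ w)) ∷ʳ b (w ∷ʳ not (Aᵇ S₁ w))))
      ≡⟨ count-cong (λ w → cong (λ z → Q ((w ∷ʳ not (Aᵇ S₁ w)) ∷ʳ not (Bᵇ S₂ z))) (init-∷ʳ _ w)) ⟩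
    count (λ w → Q (◇-point w)) ∎
    where
    B b : Vec Bool (suc (suc n)) → Bool
    B y = Bᵇ S₂ (init y)
    b y = not (B y)

module _ {n : ℕ} (S : BSet n) where

  Aᵇ-∷ʳ : (u : Vec Bool n) (c : Bool) → Aᵇ S (u ∷ʳ c) ≡ not c ∧ S u
  Aᵇ-∷ʳ u c rewrite init-∷ʳ c u | last-∷ʳ c u = refl

  Bᵇ-∷ʳ-false : (u : Vec Bool n) → Bᵇ S (u ∷ʳ false) ≡ isZeroᵇ u
  Bᵇ-∷ʳ-false u rewrite init-∷ʳ false u | last-∷ʳ false u | isZeroᵇ-∷ʳ u false =
    trans (∨-identityʳ _) (∧-identityʳ (isZeroᵇ u))

  Bᵇ-∷ʳ-true : (u : Vec Bool n) → Bᵇ S (u ∷ʳ true) ≡ S u ∧ not (isZeroᵇ u)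
  Bᵇ-∷ʳ-true u rewrite init-∷ʳ true u | last-∷ʳ true u | isZeroᵇ-∷ʳ u true =
    cong (_∨ (S u ∧ not (isZeroᵇ u))) (∧-zeroʳ (isZeroᵇ u))

  count-Aᵇ : (Q : Vec Bool (suc n) → Bool) → count (λ w → Aᵇ S w ∧ Q w) ≡ count (λ u → S u ∧ Q (u ∷ʳ false))
  count-Aᵇ Q = begin
    count (λ w → Aᵇ S w ∧ Q w)
      ≡⟨ count-∷ʳ (λ w → Aᵇ S w ∧ Q w) ⟩
    count (λ u → Aᵇ S (u ∷ʳ false) ∧ Q (u ∷ʳ false)) + count (λ u → Aᵇ S (u ∷ʳ true) ∧ Q (u ∷ʳ true))
      ≡⟨ cong₂ _+_ (count-cong (λ u → cong (_∧ Q (u ∷ʳ false)) (Aᵇ-∷ʳ u false)))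
                   (count-cong (λ u → cong (_∧ Q (u ∷ʳ true)) (Aᵇ-∷ʳ u true))) ⟩
    count (λ u → S u ∧ Q (u ∷ʳ false)) + count {n} (λ _ → false)
      ≡⟨ cong (count (λ u → S u ∧ Q (u ∷ʳ false)) +_) (count-false {n}) ⟩
    count (λ u → S u ∧ Q (u ∷ʳ false)) + 0
      ≡⟨ +-identityʳ _ ⟩
    count (λ u → S u ∧ Q (u ∷ʳ false)) ∎

  count-Bᵇ : (Q : Vec Bool (suc n) → Bool) → count (λ w → Bᵇ S w ∧ Q w)
             ≡ 𝟙 (Q (zeros n ∷ʳ false)) + count (λ u → (S u ∧ not (isZeroᵇ u)) ∧ Q (u ∷ʳ true))
  count-Bᵇ Q = begin
    count (λ w → Bᵇ S w ∧ Q w)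
      ≡⟨ count-∷ʳ (λ w → Bᵇ S w ∧ Q w) ⟩
    count (λ u → Bᵇ S (u ∷ʳ false) ∧ Q (u ∷ʳ false)) + count (λ u → Bᵇ S (u ∷ʳ true) ∧ Q (u ∷ʳ true))
      ≡⟨ cong₂ _+_ (count-cong (λ u → trans (cong (_∧ Q (u ∷ʳ false)) (Bᵇ-∷ʳ-false u)) (∧-comm (isZeroᵇ u) _)))
                   (count-cong (λ u → cong (_∧ Q (u ∷ʳ true)) (Bᵇ-∷ʳ-true u))) ⟩
    count (λ u → Q (u ∷ʳ false) ∧ isZeroᵇ u) + count (λ u → (S u ∧ not (isZeroᵇ u)) ∧ Q (u ∷ʳ true))
      ≡⟨ cong (_+ count (λ u → (S u ∧ not (isZeroᵇ u)) ∧ Q (u ∷ʳ true))) (count-∧-isZeroᵇ (λ u → Q (u ∷ʳ false))) ⟩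
    𝟙 (Q (zeros n ∷ʳ false)) + count (λ u → (S u ∧ not (isZeroᵇ u)) ∧ Q (u ∷ʳ true)) ∎

  count-Bᵇ-zeros∈ : S (zeros n) ≡ true → (Q : Vec Bool (suc n) → Bool) → Q (zeros n ∷ʳ false) ≡ Q (zeros n ∷ʳ true) →
                    count (λ w → Bᵇ S w ∧ Q w) ≡ count (λ u → S u ∧ Q (u ∷ʳ true))
  count-Bᵇ-zeros∈ S0 Q Q00≡Q01 = begin
    count (λ w → Bᵇ S w ∧ Q w)
      ≡⟨ count-Bᵇ Q ⟩
    𝟙 (Q (zeros n ∷ʳ false)) + count (λ u → (S u ∧ not (isZeroᵇ u)) ∧ Q (u ∷ʳ true))
      ≡⟨ cong₂ _+_ (cong 𝟙 (trans Q00≡Q01 (cong (_∧ Q (zeros n ∷ʳ true)) (sym S0))))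
                   (count-cong (λ u → ∧.xy∙z≈xz∙y (S u) _ _)) ⟩
    𝟙 (S (zeros n) ∧ Q (zeros n ∷ʳ true)) + count (λ u → (S u ∧ Q (u ∷ʳ true)) ∧ not (isZeroᵇ u))
      ≡⟨ count-split-zeros (λ u → S u ∧ Q (u ∷ʳ true)) ⟨
    count (λ u → S u ∧ Q (u ∷ʳ true)) ∎

module _ {n : ℕ} where

  -- β and α are the two bits appended by ◇, γ the bit appended by A and B, ι i the original positions.
  β α γ : Fin (suc (suc (suc n)))
  β = fromℕ (suc (suc n))
  α = inject₁ (fromℕ (suc n))
  γ = inject₁ (inject₁ (fromℕ n))

  ι : Fin n → Fin (suc (suc (suc n)))
  ι i = inject₁ (inject₁ (inject₁ i))

  module _ (w : Vec Bool (suc n)) (a b : Bool) where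

    lookup-β : lookup ((w ∷ʳ a) ∷ʳ b) β ≡ b
    lookup-β = lookup-∷ʳ-fromℕ (w ∷ʳ a) b

    lookup-α : lookup ((w ∷ʳ a) ∷ʳ b) α ≡ a
    lookup-α = trans (lookup-∷ʳ-inject₁ (w ∷ʳ a) b (fromℕ (suc n))) (lookup-∷ʳ-fromℕ w a)

    lookup-inner : (j : Fin (suc n)) → lookup ((w ∷ʳ a) ∷ʳ b) (inject₁ (inject₁ j)) ≡ lookup w j
    lookup-inner j = trans (lookup-∷ʳ-inject₁ (w ∷ʳ a) b (inject₁ j)) (lookup-∷ʳ-inject₁ w a j)

  lookup-γ : (u : Vec Bool n) (c a b : Bool) → lookup (((u ∷ʳ c) ∷ʳ a) ∷ʳ b) γ ≡ c
  lookup-γ u c a b = trans (lookup-inner (u ∷ʳ c) a b (fromℕ n)) (lookup-∷ʳ-fromℕ u c)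

  lookup-ι : (u : Vec Bool n) (c a b : Bool) (i : Fin n) → lookup (((u ∷ʳ c) ∷ʳ a) ∷ʳ b) (ι i) ≡ lookup u i
  lookup-ι u c a b i = trans (lookup-inner (u ∷ʳ c) a b (inject₁ i)) (lookup-∷ʳ-inject₁ u c i)

module _ {n : ℕ} (S₁ S₂ : BSet n) (w : Vec Bool (suc n)) where

  ◇-point-β : lookup (◇-point S₁ S₂ w) β ≡ not (Bᵇ S₂ w)
  ◇-point-β = lookup-β w _ _

  ◇-point-α : lookup (◇-point S₁ S₂ w) α ≡ not (Aᵇ S₁ w)
  ◇-point-α = lookup-α w _ _

  ◇-point-inner : (j : Fin (suc n)) → lookup (◇-point S₁ S₂ w) (inject₁ (inject₁ j)) ≡ lookup w j
  ◇-point-inner = lookup-inner w _ _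

module _ {n : ℕ} (S₁ S₂ : BSet n) where

  size-◇ : size (S₁ ◇ S₂) ≡ 2 ^ suc n
  size-◇ = begin
    count (S₁ ◇ S₂)                   ≡⟨ count-cong (λ x → sym (∧-identityʳ ((S₁ ◇ S₂) x))) ⟩
    count (λ x → (S₁ ◇ S₂) x ∧ true)  ≡⟨ count-◇ S₁ S₂ (λ _ → true) ⟩
    count {suc n} (λ _ → true)        ≡⟨ count-true {suc n} ⟩
    2 ^ suc n                         ∎

  ◇-point-1-at : (e : Fin (suc (suc (suc n)))) → ∃ λ w → lookup (◇-point S₁ S₂ w) e ≡ true
  ◇-point-1-at e with view e
  ... | ‵fromℕ = zeros n ∷ʳ true , (begin
    lookup (◇-point S₁ S₂ (zeros n ∷ʳ true)) β    ≡⟨ ◇-point-β S₁ S₂ (zeros n ∷ʳ true) ⟩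
    not (Bᵇ S₂ (zeros n ∷ʳ true))                 ≡⟨ cong not (Bᵇ-∷ʳ-true S₂ (zeros n)) ⟩
    not (S₂ (zeros n) ∧ not (isZeroᵇ (zeros n)))  ≡⟨ cong (λ b → not (S₂ (zeros n) ∧ not b)) (isZeroᵇ-zeros n) ⟩
    not (S₂ (zeros n) ∧ false)                    ≡⟨ cong not (∧-zeroʳ (S₂ (zeros n))) ⟩
    true                                          ∎)
  ... | ‵inject₁ k = ones , (begin
    lookup (◇-point S₁ S₂ ones) (inject₁ k)    ≡⟨ lookup-∷ʳ-inject₁ (ones ∷ʳ not (Aᵇ S₁ ones)) _ k ⟩
    lookup (ones ∷ʳ not (Aᵇ S₁ ones)) k        ≡⟨ cong (λ b → lookup (ones ∷ʳ not b) k) (Aᵇ-∷ʳ S₁ _ true) ⟩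
    lookup (ones ∷ʳ true) k                    ≡⟨ cong (λ v → lookup (v ∷ʳ true) k) (replicate-∷ʳ n true) ⟩
    lookup (replicate (suc n) true ∷ʳ true) k  ≡⟨ cong (λ v → lookup v k) (replicate-∷ʳ (suc n) true) ⟩
    lookup (replicate (suc (suc n)) true) k    ≡⟨ lookup-replicate k true ⟩
    true                                       ∎)
    where
    ones : Vec Bool (suc n)
    ones = replicate n true ∷ʳ true

  loopless-◇ : Loopless (S₁ ◇ S₂)
  loopless-◇ e loop with ◇-point-1-at e
  ... | w , wₑ≡true = contradiction (trans (sym wₑ≡true) (loop (◇-point S₁ S₂ w) (◇-point∈◇ S₁ S₂ w))) λ ()

frameless-◇ : {n : ℕ} {S₁ S₂ : BSet (suc n)} → Loopless S₁ → Loopless S₂ → Frameless (S₁ ◇ S₂)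
frameless-◇ {n} {S₁} {S₂} S₁-loopless S₂-loopless e frame with view e
... | ‵fromℕ = S₂-loopless zero (IsLoop-intro λ u S₂u u₀ →
  IsFrame-nonzero frame (◇-point S₁ S₂ (u ∷ʳ true)) (◇-point∈◇ S₁ S₂ (u ∷ʳ true)) γ (lookup-γ u true _ _) (begin
    lookup (◇-point S₁ S₂ (u ∷ʳ true)) β  ≡⟨ ◇-point-β S₁ S₂ (u ∷ʳ true) ⟩
    not (Bᵇ S₂ (u ∷ʳ true))               ≡⟨ cong not (Bᵇ-∷ʳ-true S₂ u) ⟩
    not (S₂ u ∧ not (isZeroᵇ u))          ≡⟨ cong (λ b → not (S₂ u ∧ not b)) (lookup≡true⇒isZeroᵇ≡false u zero u₀) ⟩
    not (S₂ u ∧ true)                     ≡⟨ cong not (trans (∧-identityʳ (S₂ u)) S₂u) ⟩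
    false                                 ∎))
... | ‵inj₁ ‵fromℕ = S₁-loopless zero (IsLoop-intro λ u S₁u u₀ →
  IsFrame-nonzero frame (◇-point S₁ S₂ (u ∷ʳ false)) (◇-point∈◇ S₁ S₂ (u ∷ʳ false))
    (ι zero) (trans (lookup-ι u false _ _ zero) u₀)
    (trans (◇-point-α S₁ S₂ (u ∷ʳ false)) (cong not (trans (Aᵇ-∷ʳ S₁ u false) S₁u))))
... | ‵inj₁ (‵inj₁ ‵fromℕ) = S₁-loopless zero (IsLoop-intro λ u S₁u u₀ →
  IsFrame-nonzero frame (◇-point S₁ S₂ (u ∷ʳ false)) (◇-point∈◇ S₁ S₂ (u ∷ʳ false))
    (ι zero) (trans (lookup-ι u false _ _ zero) u₀) (lookup-γ u false _ _))
... | ‵inj₁ (‵inj₁ (‵inject₁ i)) =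
  IsFrame-nonzero frame (◇-point S₁ S₂ (zeros (suc n) ∷ʳ true)) (◇-point∈◇ S₁ S₂ (zeros (suc n) ∷ʳ true))
    γ (lookup-γ (zeros (suc n)) true _ _) (trans (lookup-ι (zeros (suc n)) true _ _ i) (lookup-replicate i false))

module _ {n : ℕ} (X : Vec Bool (suc n)) where

  count-Aᵇ-zeroOnᵇ : (S : BSet n) → count (λ w → Aᵇ S w ∧ zeroOnᵇ X w) ≡ count (λ u → S u ∧ zeroOnᵇ (init X) u)
  count-Aᵇ-zeroOnᵇ S = trans (count-Aᵇ S (zeroOnᵇ X)) (count-cong (λ u → cong (S u ∧_) (zeroOnᵇ-∷ʳ-false X u)))

  IsPowerOfTwo-count-Bᵇ-zeroOnᵇ : {S : BSet n} → Powerful S → IsPowerOfTwo (count (λ w → Bᵇ S w ∧ zeroOnᵇ X w))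
  IsPowerOfTwo-count-Bᵇ-zeroOnᵇ {S} S-powerful = with-last (last X) refl
    where
    top : ∀ {b} → last X ≡ b → ∀ u → zeroOnᵇ X (u ∷ʳ true) ≡ zeroOnᵇ (init X) u ∧ not b
    top last≡b u = trans (zeroOnᵇ-∷ʳ-true X u) (cong (λ b → zeroOnᵇ (init X) u ∧ not b) last≡b)
    with-last : ∀ b → last X ≡ b → IsPowerOfTwo (count (λ w → Bᵇ S w ∧ zeroOnᵇ X w))
    with-last false last≡false = subst IsPowerOfTwo (sym (begin
      count (λ w → Bᵇ S w ∧ zeroOnᵇ X w)
        ≡⟨ count-Bᵇ-zeros∈ S (Powerful⇒zeros∈ S-powerful) (zeroOnᵇ X)
             (trans (zeroOnᵇ-∷ʳ-false X (zeros n)) (sym (trans (top last≡false (zeros n)) (∧-identityʳ _)))) ⟩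
      count (λ u → S u ∧ zeroOnᵇ X (u ∷ʳ true))
        ≡⟨ count-cong (λ u → cong (S u ∧_) (trans (top last≡false u) (∧-identityʳ _))) ⟩
      count (λ u → S u ∧ zeroOnᵇ (init X) u) ∎))
      (S-powerful (init X))
    with-last true last≡true = 0 , (begin
      count (λ w → Bᵇ S w ∧ zeroOnᵇ X w)
        ≡⟨ count-Bᵇ S (zeroOnᵇ X) ⟩
      𝟙 (zeroOnᵇ X (zeros n ∷ʳ false)) + count (λ u → (S u ∧ not (isZeroᵇ u)) ∧ zeroOnᵇ X (u ∷ʳ true))
        ≡⟨ cong₂ _+_ (cong 𝟙 (trans (zeroOnᵇ-∷ʳ-false X (zeros n)) (zeroOnᵇ-zeros (init X))))
                     (count-cong (λ u → trans (cong ((S u ∧ not (isZeroᵇ u)) ∧_)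
                                                    (trans (top last≡true u) (∧-zeroʳ _))) (∧-zeroʳ _))) ⟩
      1 + count {n} (λ _ → false)
        ≡⟨ cong (1 +_) (count-false {n}) ⟩
      1 ∎)

  count-Aᵇ-Bᵇ-zeroOnᵇ : (S₁ S₂ : BSet n) → S₁ (zeros n) ≡ true →
                        count (λ w → Aᵇ S₁ w ∧ (Bᵇ S₂ w ∧ zeroOnᵇ X w)) ≡ 1
  count-Aᵇ-Bᵇ-zeroOnᵇ S₁ S₂ S₁0 = begin
    count (λ w → Aᵇ S₁ w ∧ (Bᵇ S₂ w ∧ zeroOnᵇ X w))
      ≡⟨ count-Aᵇ S₁ (λ w → Bᵇ S₂ w ∧ zeroOnᵇ X w) ⟩
    count (λ u → S₁ u ∧ (Bᵇ S₂ (u ∷ʳ false) ∧ zeroOnᵇ X (u ∷ʳ false)))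
      ≡⟨ count-cong (λ u → trans (cong (λ b → S₁ u ∧ (b ∧ zeroOnᵇ X (u ∷ʳ false))) (Bᵇ-∷ʳ-false S₂ u))
                                 (∧.x∙yz≈xz∙y (S₁ u) _ _)) ⟩
    count (λ u → (S₁ u ∧ zeroOnᵇ X (u ∷ʳ false)) ∧ isZeroᵇ u)
      ≡⟨ count-∧-isZeroᵇ (λ u → S₁ u ∧ zeroOnᵇ X (u ∷ʳ false)) ⟩
    𝟙 (S₁ (zeros n) ∧ zeroOnᵇ X (zeros n ∷ʳ false))
      ≡⟨ cong 𝟙 (cong₂ _∧_ S₁0 (trans (zeroOnᵇ-∷ʳ-false X (zeros n)) (zeroOnᵇ-zeros (init X)))) ⟩
    1 ∎

module _ {n : ℕ} (S₁ S₂ : BSet n) where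

  zeroOnᵇ-◇-point : (X : Vec Bool (suc n)) (x₁ x₂ : Bool) (w : Vec Bool (suc n)) →
    zeroOnᵇ ((X ∷ʳ x₁) ∷ʳ x₂) (◇-point S₁ S₂ w) ≡ (not x₁ ∨ Aᵇ S₁ w) ∧ ((not x₂ ∨ Bᵇ S₂ w) ∧ zeroOnᵇ X w)
  zeroOnᵇ-◇-point X x₁ x₂ w = begin
    zeroOnᵇ ((X ∷ʳ x₁) ∷ʳ x₂) (◇-point S₁ S₂ w)
      ≡⟨ zeroOnᵇ-∷ʳ (X ∷ʳ x₁) (w ∷ʳ not (Aᵇ S₁ w)) x₂ _ ⟩
    zeroOnᵇ (X ∷ʳ x₁) (w ∷ʳ not (Aᵇ S₁ w)) ∧ not (x₂ ∧ not (Bᵇ S₂ w))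
      ≡⟨ cong₂ _∧_ (zeroOnᵇ-∷ʳ X w x₁ _) (not-∧-not x₂ (Bᵇ S₂ w)) ⟩
    (zeroOnᵇ X w ∧ not (x₁ ∧ not (Aᵇ S₁ w))) ∧ (not x₂ ∨ Bᵇ S₂ w)
      ≡⟨ cong (λ b → (zeroOnᵇ X w ∧ b) ∧ (not x₂ ∨ Bᵇ S₂ w)) (not-∧-not x₁ (Aᵇ S₁ w)) ⟩
    (zeroOnᵇ X w ∧ (not x₁ ∨ Aᵇ S₁ w)) ∧ (not x₂ ∨ Bᵇ S₂ w)
      ≡⟨ ∧.xy∙z≈y∙zx (zeroOnᵇ X w) _ _ ⟩
    (not x₁ ∨ Aᵇ S₁ w) ∧ ((not x₂ ∨ Bᵇ S₂ w) ∧ zeroOnᵇ X w) ∎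
    where
    not-∧-not : ∀ x a → not (x ∧ not a) ≡ not x ∨ a
    not-∧-not false a = refl
    not-∧-not true  a = not-involutive a

  powerful-◇ : Powerful S₁ → Powerful S₂ → Powerful (S₁ ◇ S₂)
  powerful-◇ S₁-powerful S₂-powerful X with initLast X
  ... | X′ , x₂ , refl with initLast X′
  ... | X₀ , x₁ , refl = subst IsPowerOfTwo
    (sym (trans (count-◇ S₁ S₂ (zeroOnᵇ ((X₀ ∷ʳ x₁) ∷ʳ x₂))) (count-cong (zeroOnᵇ-◇-point X₀ x₁ x₂))))
    (cell x₁ x₂)
    where
    cell : ∀ x₁ x₂ → IsPowerOfTwo (count (λ w → (not x₁ ∨ Aᵇ S₁ w) ∧ ((not x₂ ∨ Bᵇ S₂ w) ∧ zeroOnᵇ X₀ w)))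
    cell false false = count-zeroOnᵇ X₀
    cell true  false = subst IsPowerOfTwo (sym (count-Aᵇ-zeroOnᵇ X₀ S₁)) (S₁-powerful (init X₀))
    cell false true  = IsPowerOfTwo-count-Bᵇ-zeroOnᵇ X₀ S₂-powerful
    cell true  true  = 0 , count-Aᵇ-Bᵇ-zeroOnᵇ X₀ S₁ S₂ (Powerful⇒zeros∈ S₁-powerful)

  ◇-Linear⇒full : Linear (S₁ ◇ S₂) → ∀ v → S₁ v ≡ true
  ◇-Linear⇒full (_ , closed) v = ∧-conicalʳ (c xor Bᵇ S₂ (v ∷ʳ false)) (S₁ v) (begin
    (c xor Bᵇ S₂ (v ∷ʳ false)) ∧ S₁ v
      ≡⟨ cong ((c xor Bᵇ S₂ (v ∷ʳ false)) ∧_) (Aᵇ-∷ʳ S₁ v false) ⟨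
    (c xor Bᵇ S₂ (v ∷ʳ false)) ∧ Aᵇ S₁ (v ∷ʳ false)
      ≡⟨ ◇-∷ʳ S₁ S₂ (v ∷ʳ false) false c ⟨
    (S₁ ◇ S₂) (((v ∷ʳ false) ∷ʳ false) ∷ʳ c)
      ≡⟨ cong (S₁ ◇ S₂) x⊕y ⟨
    (S₁ ◇ S₂) (zipWith _xor_ x y)
      ≡⟨ closed x y (◇-point∈◇ S₁ S₂ (v ∷ʳ true)) (◇-point∈◇ S₁ S₂ (zeros n ∷ʳ true)) ⟩
    true ∎)
    where
    x y : Vec Bool (suc (suc (suc n)))
    x = ◇-point S₁ S₂ (v ∷ʳ true)
    y = ◇-point S₁ S₂ (zeros n ∷ʳ true)
    c : Bool
    c = not (Bᵇ S₂ (v ∷ʳ true)) xor not (Bᵇ S₂ (zeros n ∷ʳ true))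
    x⊕y : zipWith _xor_ x y ≡ ((v ∷ʳ false) ∷ʳ false) ∷ʳ c
    x⊕y = begin
      zipWith _xor_ x y
        ≡⟨ zipWith-∷ʳ _xor_ ((v ∷ʳ true) ∷ʳ a₁) ((zeros n ∷ʳ true) ∷ʳ a₀) _ _ ⟩
      zipWith _xor_ ((v ∷ʳ true) ∷ʳ a₁) ((zeros n ∷ʳ true) ∷ʳ a₀) ∷ʳ c
        ≡⟨ cong (_∷ʳ c) (zipWith-∷ʳ _xor_ (v ∷ʳ true) (zeros n ∷ʳ true) a₁ a₀) ⟩
      (zipWith _xor_ (v ∷ʳ true) (zeros n ∷ʳ true) ∷ʳ (a₁ xor a₀)) ∷ʳ c
        ≡⟨ cong (λ u → (u ∷ʳ (a₁ xor a₀)) ∷ʳ c)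
                (trans (zipWith-∷ʳ _xor_ v (zeros n) true true) (cong (_∷ʳ false) (xor-zeros v))) ⟩
      ((v ∷ʳ false) ∷ʳ (a₁ xor a₀)) ∷ʳ c
        ≡⟨ cong (λ a → ((v ∷ʳ false) ∷ʳ a) ∷ʳ c)
                (cong₂ (λ p q → not p xor not q) (Aᵇ-∷ʳ S₁ v true) (Aᵇ-∷ʳ S₁ (zeros n) true)) ⟩
      ((v ∷ʳ false) ∷ʳ false) ∷ʳ c ∎
      where
      a₁ a₀ : Bool
      a₁ = not (Aᵇ S₁ (v ∷ʳ true))
      a₀ = not (Aᵇ S₁ (zeros n ∷ʳ true))

  nonlinear-◇ : size S₁ ≢ 2 ^ n → ¬ Linear (S₁ ◇ S₂)
  nonlinear-◇ S₁-not-full linear = S₁-not-full (trans (count-cong (◇-Linear⇒full linear)) (count-true {n}))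

-- Zero counts and the cancellation of ◇

module _ {N : ℕ} where

  zeroCount : BSet N → Fin N → ℕ
  zeroCount D p = count (λ x → D x ∧ not (lookup x p))

  zeroCount₂ : BSet N → Fin N → Fin N → ℕ
  zeroCount₂ D p = zeroCount (λ x → D x ∧ not (lookup x p))

  zeroCount-≅ : {D D′ : BSet N} (σ : Permutation′ N) → (∀ v → D v ≡ D′ (permuteVec σ v)) →
                ∀ q → zeroCount D (σ ⟨$⟩ʳ q) ≡ zeroCount D′ q
  zeroCount-≅ {D} {D′} σ D≗D′∘σ q = begin
    count (λ v → D v ∧ not (lookup v (σ ⟨$⟩ʳ q)))
      ≡⟨ count-cong (λ v → cong₂ (λ a b → a ∧ not b) (D≗D′∘σ v) (sym (lookup-permuteVec σ v q))) ⟩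
    count (λ v → D′ (permuteVec σ v) ∧ not (lookup (permuteVec σ v) q))
      ≡⟨ count-∘-inverse (λ y → D′ y ∧ not (lookup y q)) (permuteVec σ) (permuteVec (flip σ))
                         (permuteVec-flip (flip σ)) (permuteVec-flip σ) ⟩
    count (λ y → D′ y ∧ not (lookup y q)) ∎

  zeroCount₂-≅ : {D D′ : BSet N} (σ : Permutation′ N) → (∀ v → D v ≡ D′ (permuteVec σ v)) →
                 ∀ p q → zeroCount₂ D (σ ⟨$⟩ʳ p) (σ ⟨$⟩ʳ q) ≡ zeroCount₂ D′ p q
  zeroCount₂-≅ σ D≗D′∘σ p = zeroCount-≅ σ (λ v →
    cong₂ (λ a b → a ∧ not b) (D≗D′∘σ v) (sym (lookup-permuteVec σ v p)))

module _ {n : ℕ} (S₁ S₂ : BSet n) where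

  private
    E : BSet (suc (suc (suc n)))
    E = S₁ ◇ S₂

  zeroCount-◇ : (p : Fin (suc (suc (suc n)))) →
                zeroCount E p ≡ count (λ w → not (lookup (◇-point S₁ S₂ w) p))
  zeroCount-◇ p = count-◇ S₁ S₂ (λ x → not (lookup x p))

  zeroCount₂-◇ : (p q : Fin (suc (suc (suc n)))) →
                 zeroCount₂ E p q ≡ count (λ w → not (lookup (◇-point S₁ S₂ w) p) ∧ not (lookup (◇-point S₁ S₂ w) q))
  zeroCount₂-◇ p q =
    trans (count-cong (λ x → ∧-assoc (E x) _ _)) (count-◇ S₁ S₂ (λ x → not (lookup x p) ∧ not (lookup x q)))

  zeroCount-◇-inner : (j : Fin (suc n)) → zeroCount E (inject₁ (inject₁ j)) ≡ 2 ^ n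
  zeroCount-◇-inner j = begin
    zeroCount E (inject₁ (inject₁ j))
      ≡⟨ zeroCount-◇ (inject₁ (inject₁ j)) ⟩
    count (λ w → not (lookup (◇-point S₁ S₂ w) (inject₁ (inject₁ j))))
      ≡⟨ count-cong (λ w → cong not (◇-point-inner S₁ S₂ w j)) ⟩
    count (λ w → not (lookup w j))
      ≡⟨ count-not-lookup j ⟩
    2 ^ n ∎

  zeroCount-◇-α : zeroCount E α ≡ size S₁
  zeroCount-◇-α = begin
    zeroCount E α
      ≡⟨ zeroCount-◇ α ⟩
    count (λ w → not (lookup (◇-point S₁ S₂ w) α))
      ≡⟨ count-cong (λ w → trans (cong not (◇-point-α S₁ S₂ w)) (trans (not-involutive _) (sym (∧-identityʳ _)))) ⟩
    count (λ w → Aᵇ S₁ w ∧ true)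
      ≡⟨ count-Aᵇ S₁ (λ _ → true) ⟩
    count (λ u → S₁ u ∧ true)
      ≡⟨ count-cong (λ u → ∧-identityʳ (S₁ u)) ⟩
    size S₁ ∎

  zeroCount-◇-β : S₂ (zeros n) ≡ true → zeroCount E β ≡ size S₂
  zeroCount-◇-β S₂0 = begin
    zeroCount E β
      ≡⟨ zeroCount-◇ β ⟩
    count (λ w → not (lookup (◇-point S₁ S₂ w) β))
      ≡⟨ count-cong (λ w → trans (cong not (◇-point-β S₁ S₂ w)) (trans (not-involutive _) (sym (∧-identityʳ _)))) ⟩
    count (λ w → Bᵇ S₂ w ∧ true)
      ≡⟨ count-Bᵇ-zeros∈ S₂ S₂0 (λ _ → true) refl ⟩
    count (λ u → S₂ u ∧ true)
      ≡⟨ count-cong (λ u → ∧-identityʳ (S₂ u)) ⟩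
    size S₂ ∎

  zeroCount₂-◇-α : (j : Fin (suc n)) →
                   zeroCount₂ E α (inject₁ (inject₁ j)) ≡ count (λ u → S₁ u ∧ not (lookup (u ∷ʳ false) j))
  zeroCount₂-◇-α j = begin
    zeroCount₂ E α (inject₁ (inject₁ j))
      ≡⟨ zeroCount₂-◇ α (inject₁ (inject₁ j)) ⟩
    count (λ w → not (lookup (◇-point S₁ S₂ w) α) ∧ not (lookup (◇-point S₁ S₂ w) (inject₁ (inject₁ j))))
      ≡⟨ count-cong (λ w → cong₂ (λ a b → not a ∧ not b) (◇-point-α S₁ S₂ w) (◇-point-inner S₁ S₂ w j)) ⟩
    count (λ w → not (not (Aᵇ S₁ w)) ∧ not (lookup w j))
      ≡⟨ count-cong (λ w → cong (_∧ not (lookup w j)) (not-involutive _)) ⟩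
    count (λ w → Aᵇ S₁ w ∧ not (lookup w j))
      ≡⟨ count-Aᵇ S₁ (λ w → not (lookup w j)) ⟩
    count (λ u → S₁ u ∧ not (lookup (u ∷ʳ false) j)) ∎

  zeroCount₂-◇-β : (j : Fin (suc n)) →
                   zeroCount₂ E β (inject₁ (inject₁ j)) ≡ count (λ w → Bᵇ S₂ w ∧ not (lookup w j))
  zeroCount₂-◇-β j = begin
    zeroCount₂ E β (inject₁ (inject₁ j))
      ≡⟨ zeroCount₂-◇ β (inject₁ (inject₁ j)) ⟩
    count (λ w → not (lookup (◇-point S₁ S₂ w) β) ∧ not (lookup (◇-point S₁ S₂ w) (inject₁ (inject₁ j))))
      ≡⟨ count-cong (λ w → cong₂ (λ a b → not a ∧ not b) (◇-point-β S₁ S₂ w) (◇-point-inner S₁ S₂ w j)) ⟩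
    count (λ w → not (not (Bᵇ S₂ w)) ∧ not (lookup w j))
      ≡⟨ count-cong (λ w → cong (_∧ not (lookup w j)) (not-involutive _)) ⟩
    count (λ w → Bᵇ S₂ w ∧ not (lookup w j)) ∎

  zeroCount₂-◇-αγ : zeroCount₂ E α γ ≡ zeroCount E α
  zeroCount₂-◇-αγ = begin
    zeroCount₂ E α γ
      ≡⟨ zeroCount₂-◇-α (fromℕ n) ⟩
    count (λ u → S₁ u ∧ not (lookup (u ∷ʳ false) (fromℕ n)))
      ≡⟨ count-cong (λ u → cong (λ b → S₁ u ∧ not b) (lookup-∷ʳ-fromℕ u false)) ⟩
    count (λ u → S₁ u ∧ true)
      ≡⟨ count-cong (λ u → ∧-identityʳ (S₁ u)) ⟩
    size S₁
      ≡⟨ zeroCount-◇-α ⟨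
    zeroCount E α ∎

  zeroCount₂-◇-αι : (i : Fin n) → zeroCount₂ E α (ι i) ≡ count (λ u → S₁ u ∧ not (lookup u i))
  zeroCount₂-◇-αι i = trans (zeroCount₂-◇-α (inject₁ i))
    (count-cong (λ u → cong (λ b → S₁ u ∧ not b) (lookup-∷ʳ-inject₁ u false i)))

  zeroCount₂-◇-βγ : zeroCount₂ E β γ ≡ 1
  zeroCount₂-◇-βγ = begin
    zeroCount₂ E β γ
      ≡⟨ zeroCount₂-◇-β (fromℕ n) ⟩
    count (λ w → Bᵇ S₂ w ∧ not (lookup w (fromℕ n)))
      ≡⟨ count-Bᵇ S₂ (λ w → not (lookup w (fromℕ n))) ⟩
    𝟙 (not (lookup (zeros n ∷ʳ false) (fromℕ n)))
      + count (λ u → (S₂ u ∧ not (isZeroᵇ u)) ∧ not (lookup (u ∷ʳ true) (fromℕ n)))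
      ≡⟨ cong₂ _+_ (cong (𝟙 ∘ not) (lookup-∷ʳ-fromℕ (zeros n) false))
                   (count-cong (λ u → trans (cong (λ b → (S₂ u ∧ not (isZeroᵇ u)) ∧ not b) (lookup-∷ʳ-fromℕ u true))
                                            (∧-zeroʳ _))) ⟩
    1 + count {n} (λ _ → false)
      ≡⟨ cong (1 +_) (count-false {n}) ⟩
    1 ∎

  zeroCount₂-◇-βι : S₂ (zeros n) ≡ true → (i : Fin n) →
                    zeroCount₂ E β (ι i) ≡ count (λ u → S₂ u ∧ not (lookup u i))
  zeroCount₂-◇-βι S₂0 i = begin
    zeroCount₂ E β (ι i)
      ≡⟨ zeroCount₂-◇-β (inject₁ i) ⟩
    count (λ w → Bᵇ S₂ w ∧ not (lookup w (inject₁ i)))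
      ≡⟨ count-Bᵇ-zeros∈ S₂ S₂0 (λ w → not (lookup w (inject₁ i)))
           (cong not (trans (lookup-∷ʳ-inject₁ (zeros n) false i) (sym (lookup-∷ʳ-inject₁ (zeros n) true i)))) ⟩
    count (λ u → S₂ u ∧ not (lookup (u ∷ʳ true) (inject₁ i)))
      ≡⟨ count-cong (λ u → cong (λ b → S₂ u ∧ not b) (lookup-∷ʳ-inject₁ u true i)) ⟩
    count (λ u → S₂ u ∧ not (lookup u i)) ∎

  ◇-zeroCount≢⇒αβ : ∀ p → zeroCount E p ≢ 2 ^ n → p ≡ α ⊎ p ≡ β
  ◇-zeroCount≢⇒αβ p zeroCount≢ with view p
  ... | ‵fromℕ             = inj₂ refl
  ... | ‵inj₁ ‵fromℕ       = inj₁ refl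
  ... | ‵inj₁ (‵inject₁ j) = contradiction (zeroCount-◇-inner j) zeroCount≢

  ◇-zeroCount≡⇒inner : size S₁ ≢ 2 ^ n → size S₂ ≢ 2 ^ n → S₂ (zeros n) ≡ true →
                       ∀ p → zeroCount E p ≡ 2 ^ n → ∃ λ j → p ≡ inject₁ (inject₁ j)
  ◇-zeroCount≡⇒inner S₁≢ S₂≢ S₂0 p zeroCount≡ with view p
  ... | ‵fromℕ             = contradiction (trans (sym (zeroCount-◇-β S₂0)) zeroCount≡) S₂≢
  ... | ‵inj₁ ‵fromℕ       = contradiction (trans (sym zeroCount-◇-α) zeroCount≡) S₁≢
  ... | ‵inj₁ (‵inject₁ j) = j , refl

  ◇-recover₁ : (v : Vec Bool n) → S₁ v ≡ E (((v ∷ʳ false) ∷ʳ false) ∷ʳ not (isZeroᵇ v))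
  ◇-recover₁ v = sym (begin
    E (((v ∷ʳ false) ∷ʳ false) ∷ʳ not (isZeroᵇ v))
      ≡⟨ ◇-∷ʳ S₁ S₂ (v ∷ʳ false) false _ ⟩
    (not (isZeroᵇ v) xor Bᵇ S₂ (v ∷ʳ false)) ∧ Aᵇ S₁ (v ∷ʳ false)
      ≡⟨ cong₂ (λ b a → (not (isZeroᵇ v) xor b) ∧ a) (Bᵇ-∷ʳ-false S₂ v) (Aᵇ-∷ʳ S₁ v false) ⟩
    (not (isZeroᵇ v) xor isZeroᵇ v) ∧ S₁ v
      ≡⟨ cong (_∧ S₁ v) (xor-inverseˡ (isZeroᵇ v)) ⟩
    S₁ v ∎)

  ◇-recover₂ : S₂ (zeros n) ≡ true → (v : Vec Bool n) →
               S₂ v ≡ isZeroᵇ v ∨ E (((v ∷ʳ true) ∷ʳ true) ∷ʳ false)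
  ◇-recover₂ S₂0 v = sym (begin
    isZeroᵇ v ∨ E (((v ∷ʳ true) ∷ʳ true) ∷ʳ false)
      ≡⟨ cong (isZeroᵇ v ∨_) (◇-∷ʳ S₁ S₂ (v ∷ʳ true) true false) ⟩
    isZeroᵇ v ∨ (Bᵇ S₂ (v ∷ʳ true) ∧ not (Aᵇ S₁ (v ∷ʳ true)))
      ≡⟨ cong₂ (λ b a → isZeroᵇ v ∨ (b ∧ not a)) (Bᵇ-∷ʳ-true S₂ v) (Aᵇ-∷ʳ S₁ v true) ⟩
    isZeroᵇ v ∨ ((S₂ v ∧ not (isZeroᵇ v)) ∧ true)
      ≡⟨ cong (isZeroᵇ v ∨_) (∧-identityʳ _) ⟩
    isZeroᵇ v ∨ (S₂ v ∧ not (isZeroᵇ v))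
      ≡⟨ zero-or-nonzero (isZeroᵇ v) refl ⟩
    S₂ v ∎)
    where
    zero-or-nonzero : ∀ b → isZeroᵇ v ≡ b → b ∨ (S₂ v ∧ not b) ≡ S₂ v
    zero-or-nonzero true  v≡0 = sym (trans (cong S₂ (isZeroᵇ≡true⇒≡zeros v v≡0)) S₂0)
    zero-or-nonzero false _   = ∧-identityʳ (S₂ v)

-- σ fixes β, α and γ, so it restricts to a permutation ρ of the original positions.
module ◇-Cancellation {n : ℕ} {S₁ S₂ S₁′ S₂′ : BSet (suc n)}
  (loopless₁ : Loopless S₁) (loopless₂ : Loopless S₂)
  (S₂0 : S₂ (zeros (suc n)) ≡ true) (S₂′0 : S₂′ (zeros (suc n)) ≡ true)
  (S₁≢ : size S₁ ≢ 2 ^ suc n) (S₂≢ : size S₂ ≢ 2 ^ suc n)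
  (S₁′≢ : size S₁′ ≢ 2 ^ suc n) (S₂′≢ : size S₂′ ≢ 2 ^ suc n)
  (σ : Permutation′ (suc (suc (suc (suc n)))))
  (E≗E′∘σ : ∀ v → (S₁ ◇ S₂) v ≡ (S₁′ ◇ S₂′) (permuteVec σ v)) where

  private
    E E′ : BSet (suc (suc (suc (suc n))))
    E  = S₁ ◇ S₂
    E′ = S₁′ ◇ S₂′

    transfer : ∀ q → zeroCount E (σ ⟨$⟩ʳ q) ≡ zeroCount E′ q
    transfer = zeroCount-≅ σ E≗E′∘σ

    σα∈αβ : σ ⟨$⟩ʳ α ≡ α ⊎ σ ⟨$⟩ʳ α ≡ β
    σα∈αβ = ◇-zeroCount≢⇒αβ S₁ S₂ (σ ⟨$⟩ʳ α) λ eq →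
      S₁′≢ (trans (sym (zeroCount-◇-α S₁′ S₂′)) (trans (sym (transfer α)) eq))

    σβ∈αβ : σ ⟨$⟩ʳ β ≡ α ⊎ σ ⟨$⟩ʳ β ≡ β
    σβ∈αβ = ◇-zeroCount≢⇒αβ S₁ S₂ (σ ⟨$⟩ʳ β) λ eq →
      S₂′≢ (trans (sym (zeroCount-◇-β S₁′ S₂′ S₂′0)) (trans (sym (transfer β)) eq))

    σγ-inner : ∃ λ j → σ ⟨$⟩ʳ γ ≡ inject₁ (inject₁ j)
    σγ-inner = ◇-zeroCount≡⇒inner S₁ S₂ S₁≢ S₂≢ S₂0 (σ ⟨$⟩ʳ γ)
      (trans (transfer γ) (zeroCount-◇-inner S₁′ S₂′ (fromℕ (suc n))))

    -- Requiring a zero at γ besides α loses no vector; besides β it always loses some (β-row<), and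
    -- besides α at an original position too (α-row<).
    αγ-tight : zeroCount₂ E (σ ⟨$⟩ʳ α) (σ ⟨$⟩ʳ γ) ≡ zeroCount E (σ ⟨$⟩ʳ α)
    αγ-tight = trans (zeroCount₂-≅ σ E≗E′∘σ α γ) (trans (zeroCount₂-◇-αγ S₁′ S₂′) (sym (transfer α)))

    β-row< : ∀ j → zeroCount₂ E β (inject₁ (inject₁ j)) < zeroCount E β
    β-row< j with view j
    ... | ‵fromℕ     = subst₂ _<_ (sym (zeroCount₂-◇-βγ S₁ S₂)) (sym (zeroCount-◇-β S₁ S₂ S₂0)) (1<size loopless₂ S₂0)
    ... | ‵inject₁ i = subst₂ _<_ (sym (zeroCount₂-◇-βι S₁ S₂ S₂0 i)) (sym (zeroCount-◇-β S₁ S₂ S₂0))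
                                 (count-not-lookup< (loopless₂ i))

    α-row< : ∀ i → zeroCount₂ E α (ι i) < zeroCount E α
    α-row< i = subst₂ _<_ (sym (zeroCount₂-◇-αι S₁ S₂ i)) (sym (zeroCount-◇-α S₁ S₂))
                          (count-not-lookup< (loopless₁ i))

    σ-fixes-α : σ ⟨$⟩ʳ α ≡ α
    σ-fixes-α with σα∈αβ | σγ-inner
    ... | inj₁ σα≡α | _         = σα≡α
    ... | inj₂ σα≡β | j , σγ≡ω = contradiction
      (subst₂ (λ p q → zeroCount₂ E p q ≡ zeroCount E p) σα≡β σγ≡ω αγ-tight) (<⇒≢ (β-row< j))

    σ-fixes-γ : σ ⟨$⟩ʳ γ ≡ γ
    σ-fixes-γ with σγ-inner
    ... | j , σγ≡ω with view j
    ... | ‵fromℕ     = σγ≡ω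
    ... | ‵inject₁ i = contradiction
      (subst₂ (λ p q → zeroCount₂ E p q ≡ zeroCount E p) σ-fixes-α σγ≡ω αγ-tight) (<⇒≢ (α-row< i))

    σ-fixes-β : σ ⟨$⟩ʳ β ≡ β
    σ-fixes-β with σβ∈αβ
    ... | inj₂ σβ≡β = σβ≡β
    ... | inj₁ σβ≡α = contradiction β≡α fromℕ≢inject₁
      where
      β≡α : β ≡ α
      β≡α = begin
        β                          ≡⟨ inverseˡ σ ⟨
        σ ⟨$⟩ˡ (σ ⟨$⟩ʳ β)          ≡⟨ cong (σ ⟨$⟩ˡ_) (trans σβ≡α (sym σ-fixes-α)) ⟩
        σ ⟨$⟩ˡ (σ ⟨$⟩ʳ α)          ≡⟨ inverseˡ σ ⟩
        α                          ∎

    σ₁ : Permutation′ (suc (suc (suc n)))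
    σ₁ = remove (fromℕ _) σ
    σ₁-top : σ₁ ⟨$⟩ʳ fromℕ _ ≡ fromℕ _
    σ₁-top = remove-fromℕ-fixes σ σ-fixes-β σ-fixes-α
    σ₂ : Permutation′ (suc (suc n))
    σ₂ = remove (fromℕ _) σ₁
    σ₂-top : σ₂ ⟨$⟩ʳ fromℕ _ ≡ fromℕ _
    σ₂-top = remove-fromℕ-fixes σ₁ σ₁-top (remove-fromℕ-fixes σ σ-fixes-β σ-fixes-γ)

  ρ : Permutation′ (suc n)
  ρ = remove (fromℕ _) σ₂

  permuteVec-σ : ∀ v a b c → permuteVec σ (((v ∷ʳ a) ∷ʳ b) ∷ʳ c) ≡ ((permuteVec ρ v ∷ʳ a) ∷ʳ b) ∷ʳ c
  permuteVec-σ v a b c = begin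
    permuteVec σ (((v ∷ʳ a) ∷ʳ b) ∷ʳ c)  ≡⟨ permuteVec-∷ʳ σ σ-fixes-β ((v ∷ʳ a) ∷ʳ b) c ⟩
    permuteVec σ₁ ((v ∷ʳ a) ∷ʳ b) ∷ʳ c   ≡⟨ cong (_∷ʳ c) (permuteVec-∷ʳ σ₁ σ₁-top (v ∷ʳ a) b) ⟩
    (permuteVec σ₂ (v ∷ʳ a) ∷ʳ b) ∷ʳ c   ≡⟨ cong (λ u → (u ∷ʳ b) ∷ʳ c) (permuteVec-∷ʳ σ₂ σ₂-top v a) ⟩
    ((permuteVec ρ v ∷ʳ a) ∷ʳ b) ∷ʳ c    ∎

  S₁≅S₁′ : S₁ ≅ S₁′
  S₁≅S₁′ = ρ , S₁≗S₁′∘ρ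
    where
    S₁≗S₁′∘ρ : ∀ v → S₁ v ≡ S₁′ (permuteVec ρ v)
    S₁≗S₁′∘ρ v = begin
      S₁ v
        ≡⟨ ◇-recover₁ S₁ S₂ v ⟩
      E x
        ≡⟨ E≗E′∘σ x ⟩
      E′ (permuteVec σ x)
        ≡⟨ cong E′ (permuteVec-σ v false false _) ⟩
      E′ (((ρv ∷ʳ false) ∷ʳ false) ∷ʳ not (isZeroᵇ v))
        ≡⟨ cong (λ b → E′ (((ρv ∷ʳ false) ∷ʳ false) ∷ʳ not b)) (isZeroᵇ-permuteVec ρ v) ⟨
      E′ (((ρv ∷ʳ false) ∷ʳ false) ∷ʳ not (isZeroᵇ ρv))
        ≡⟨ ◇-recover₁ S₁′ S₂′ ρv ⟨
      S₁′ ρv ∎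
      where
      x : Vec Bool (suc (suc (suc (suc n))))
      x = ((v ∷ʳ false) ∷ʳ false) ∷ʳ not (isZeroᵇ v)
      ρv : Vec Bool (suc n)
      ρv = permuteVec ρ v

  S₂≅S₂′ : S₂ ≅ S₂′
  S₂≅S₂′ = ρ , S₂≗S₂′∘ρ
    where
    S₂≗S₂′∘ρ : ∀ v → S₂ v ≡ S₂′ (permuteVec ρ v)
    S₂≗S₂′∘ρ v = begin
      S₂ v
        ≡⟨ ◇-recover₂ S₁ S₂ S₂0 v ⟩
      isZeroᵇ v ∨ E x
        ≡⟨ cong₂ _∨_ (sym (isZeroᵇ-permuteVec ρ v)) (E≗E′∘σ x) ⟩
      isZeroᵇ ρv ∨ E′ (permuteVec σ x)
        ≡⟨ cong (λ y → isZeroᵇ ρv ∨ E′ y) (permuteVec-σ v true true false) ⟩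
      isZeroᵇ ρv ∨ E′ (((ρv ∷ʳ true) ∷ʳ true) ∷ʳ false)
        ≡⟨ ◇-recover₂ S₁′ S₂′ S₂′0 ρv ⟨
      S₂′ ρv ∎
      where
      x : Vec Bool (suc (suc (suc (suc n))))
      x = ((v ∷ʳ true) ∷ʳ true) ∷ʳ false
      ρv : Vec Bool (suc n)
      ρv = permuteVec ρ v

theorem14 : (n : ℕ) → 2 ≤ n → (𝒮 : BSet n → Set) →
  (∀ S → 𝒮 S → Loopless S × Frameless S × Powerful S × size S ≡ 2 ^ (n ∸ 2)) →
  (∀ S T → 𝒮 S → 𝒮 T → S ≅ T → S ≐ T) →
  ((∀ S₁ S₂ → 𝒮 S₁ → 𝒮 S₂ →
      Loopless (S₁ ◇ S₂) × Frameless (S₁ ◇ S₂) × Powerful (S₁ ◇ S₂) ×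
      size (S₁ ◇ S₂) ≡ 2 ^ suc n)
   × (∀ S₁ S₂ S₁′ S₂′ → 𝒮 S₁ → 𝒮 S₂ → 𝒮 S₁′ → 𝒮 S₂′ →
      (S₁ ◇ S₂) ≅ (S₁′ ◇ S₂′) → (S₁ ≅ S₁′) × (S₂ ≅ S₂′))
   × (3 < n → ∀ S₁ S₂ → 𝒮 S₁ → 𝒮 S₂ → ¬ Linear (S₁ ◇ S₂)))
theorem14 (suc (suc m)) (s≤s (s≤s z≤n)) 𝒮 H _ = properties , cancellation , nonlinearity
  where
  loopless : ∀ S → 𝒮 S → Loopless S
  loopless S S∈𝒮 = proj₁ (H S S∈𝒮)
  powerful : ∀ S → 𝒮 S → Powerful S
  powerful S S∈𝒮 = proj₁ (proj₂ (proj₂ (H S S∈𝒮)))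
  not-full : ∀ S → 𝒮 S → size S ≢ 2 ^ suc (suc m)
  not-full S S∈𝒮 = <⇒≢ (subst (_< 2 ^ suc (suc m)) (sym (proj₂ (proj₂ (proj₂ (H S S∈𝒮)))))
                                (^-monoʳ-< 2 (s≤s (s≤s z≤n)) (m<n+m m {2} (s≤s z≤n))))

  properties : ∀ S₁ S₂ → 𝒮 S₁ → 𝒮 S₂ →
    Loopless (S₁ ◇ S₂) × Frameless (S₁ ◇ S₂) × Powerful (S₁ ◇ S₂) × size (S₁ ◇ S₂) ≡ 2 ^ suc (suc (suc m))
  properties S₁ S₂ S₁∈𝒮 S₂∈𝒮 =
    loopless-◇ S₁ S₂ , frameless-◇ (loopless S₁ S₁∈𝒮) (loopless S₂ S₂∈𝒮) ,
    powerful-◇ S₁ S₂ (powerful S₁ S₁∈𝒮) (powerful S₂ S₂∈𝒮) , size-◇ S₁ S₂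

  cancellation : ∀ S₁ S₂ S₁′ S₂′ → 𝒮 S₁ → 𝒮 S₂ → 𝒮 S₁′ → 𝒮 S₂′ →
    (S₁ ◇ S₂) ≅ (S₁′ ◇ S₂′) → (S₁ ≅ S₁′) × (S₂ ≅ S₂′)
  cancellation S₁ S₂ S₁′ S₂′ S₁∈𝒮 S₂∈𝒮 S₁′∈𝒮 S₂′∈𝒮 (σ , E≗E′∘σ) = S₁≅S₁′ , S₂≅S₂′
    where
    open ◇-Cancellation (loopless S₁ S₁∈𝒮) (loopless S₂ S₂∈𝒮)
      (Powerful⇒zeros∈ (powerful S₂ S₂∈𝒮)) (Powerful⇒zeros∈ (powerful S₂′ S₂′∈𝒮))
      (not-full S₁ S₁∈𝒮) (not-full S₂ S₂∈𝒮) (not-full S₁′ S₁′∈𝒮) (not-full S₂′ S₂′∈𝒮) σ E≗E′∘σ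

  nonlinearity : 3 < suc (suc m) → ∀ S₁ S₂ → 𝒮 S₁ → 𝒮 S₂ → ¬ Linear (S₁ ◇ S₂)
  nonlinearity _ S₁ S₂ S₁∈𝒮 _ = nonlinear-◇ S₁ S₂ (not-full S₁ S₁∈𝒮)
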